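{- For every integer $k\ge 3$, \[ F_{k,1}(q)=\frac{q}{(1-q)\left(q;q^2\right)_{k-1}}\left(1+(1-q)\sum_{n=1}^{k-2}\frac{\left(q^{4-2k};q^2\right)_n}{\left(q^2;q^2\right)_n}\,\frac{q^{(2k-1)n}}{1-q^{2n+1}}\right), \] where \[ F_{k,1}(q)=\sum_{n\ge 0}\frac{\left(q^{2n+2};q^2\right)_\infty\left(q^{2n+2k};q^2\right)_\infty}{\left(q^{2n+1};q^2\right)_\infty^2}\,q^{2n+1}. \]
   Context: For $n\in\mathbb{N}_0\cup\{\infty\}$, $(a;q)_n:=\prod_{j=0}^{n-1}(1-aq^j)$. Identities hold for $|q|<1$ (equivalently as formal power series / rational functions in $q$). -}

module Defs where

open import Data.Nat as ℕ using (ℕ; zero; suc; _∸_)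
open import Data.Integer as ℤ using (ℤ; +_; -_; _≟_)
open import Data.List using (List; []; _∷_; map; zipWith; foldr; concatMap; upTo)
open import Data.Product using (_×_; _,_)
open import Data.Bool using (if_then_else_)
open import Relation.Nullary.Decidable using (⌊_⌋)
open import Relation.Binary.PropositionalEquality using (_≡_)

-- Formal power series in q with integer coefficients: f m = [q^m] f.

PS : Set
PS = ℕ → ℤ

infix 4 _≐_
_≐_ : PS → PS → Set
f ≐ g = ∀ m → f m ≡ g m

sumℤ : List ℤ → ℤ
sumℤ = foldr ℤ._+_ (+ 0)

range : ℕ → ℕ → List ℕ
range a n = map (a ℕ.+_) (upTo n)

1ₚ : PS
1ₚ zero    = + 1
1ₚ (suc _) = + 0

X^ : ℕ → PS
X^ a m = if ⌊ a ℕ.≟ m ⌋ then + 1 else + 0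

infixl 6 _+ₚ_ _-ₚ_
infixl 7 _*ₚ_

_+ₚ_ : PS → PS → PS
(f +ₚ g) m = f m ℤ.+ g m

_-ₚ_ : PS → PS → PS
(f -ₚ g) m = f m ℤ.- g m

_*ₚ_ : PS → PS → PS
(f *ₚ g) m = sumℤ (map (λ i → f i ℤ.* g (m ∸ i)) (upTo (suc m)))

prodₚ : List PS → PS
prodₚ = foldr _*ₚ_ 1ₚ

sumₚ : List PS → PS
sumₚ = foldr _+ₚ_ (λ _ → + 0)

-- Multiplicative inverse 1/f of a power series f with f 0 = 1:
-- g 0 = 1,  g m = - Σ_{i=1}^{m} f i * g (m - i).
-- invList f m = [g m, g (m-1), ..., g 0].
invList : PS → ℕ → List ℤ
invList f zero    = + 1 ∷ []
invList f (suc m) =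
  let prev = invList f m
  in (- sumℤ (zipWith ℤ._*_ (map f (range 1 (suc m))) prev)) ∷ prev

inv : PS → PS
inv f m with invList f m
... | x ∷ _ = x
... | []    = + 0

1-q^ : ℕ → PS
1-q^ a = 1ₚ -ₚ X^ a

poch : ℕ → ℕ → ℕ → PS
poch a d n = prodₚ (map (λ j → 1-q^ (a ℕ.+ d ℕ.* j)) (upTo n))

-- infinite q-Pochhammer (q^a ; q^d)_∞ for a ≥ 1, d ≥ 1:
-- the coefficient of q^m only depends on the factors with j ≤ m
-- (further factors are 1 + O(q^(m+1))).
poch∞ : ℕ → ℕ → PS
poch∞ a d m = poch a d (suc m) m

-- infinite sum Σ_{n≥0} t n of a family with t n = O(q^n)
-- (only the terms with n ≤ m contribute to [q^m]).
sum∞ : (ℕ → PS) → PS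
sum∞ t m = sumℤ (map (λ n → t n m) (upTo (suc m)))

-- Laurent polynomials (needed for (q^(4-2k); q^2)_n), as lists of
-- (exponent , coefficient) terms.

LPoly : Set
LPoly = List (ℤ × ℤ)

1ₗ : LPoly
1ₗ = (+ 0 , + 1) ∷ []

Xₗ : ℤ → LPoly
Xₗ e = (e , + 1) ∷ []

_*ₗ_ : LPoly → LPoly → LPoly
p *ₗ r = concatMap (λ { (e , c) → map (λ { (e' , c') → (e ℤ.+ e' , c ℤ.* c') }) r }) p

pochₗ : ℤ → ℤ → ℕ → LPoly
pochₗ a d n = foldr _*ₗ_ 1ₗ
  (map (λ j → (+ 0 , + 1) ∷ (a ℤ.+ d ℤ.* + j , - + 1) ∷ []) (upTo n))

-- the nonnegative-exponent part of a Laurent polynomial as a power series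
-- (applied below only to genuine polynomials)
toPS : LPoly → PS
toPS p m = sumℤ (map (λ { (e , c) → if ⌊ e ≟ + m ⌋ then c else + 0 }) p)

F₁ : ℕ → PS
F₁ k = sum∞ λ n →
  poch∞ (2 ℕ.* n ℕ.+ 2) 2 *ₚ poch∞ (2 ℕ.* n ℕ.+ 2 ℕ.* k) 2
  *ₚ inv (poch∞ (2 ℕ.* n ℕ.+ 1) 2 *ₚ poch∞ (2 ℕ.* n ℕ.+ 1) 2)
  *ₚ X^ (2 ℕ.* n ℕ.+ 1)

-- (q^{4-2k};q^2)_n q^{(2k-1)n}, a polynomial in q
numTerm : ℕ → ℕ → PS
numTerm k n = toPS (pochₗ (+ 4 ℤ.- + (2 ℕ.* k)) (+ 2) n *ₗ Xₗ (+ ((2 ℕ.* k ∸ 1) ℕ.* n)))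

RHS : ℕ → PS
RHS k =
  X^ 1 *ₚ inv (1-q^ 1 *ₚ poch 1 2 (k ∸ 1)) *ₚ
  (1ₚ +ₚ 1-q^ 1 *ₚ
     sumₚ (map (λ n → numTerm k n *ₚ inv (poch 2 2 n) *ₚ inv (1-q^ (2 ℕ.* n ℕ.+ 1)))
               (range 1 (k ∸ 2))))

{-# OPTIONS --safe #-}
-- Proof by telescoping.  Put p = q², N = k - 2, and for m ≤ N let
--
--   R_m(n) = (q^(2n); p)_∞ (q^(2n+2m+2); p)_∞ / ((q^(2n+1); p)_∞ (q^(2n+2m+1); p)_∞),
--
-- so that R_m(0) = 0 and R_m(n) → 1.  Shifting each Pochhammer symbol by one factor gives
--
--   R_m(n+1) - R_m(n) = q^(2n) (1 - q) (1 - q^(2m+1)) (q^(2n+2); p)_∞ (q^(2n+2m+4); p)_∞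
--                       / ((q^(2n+1); p)_∞ (q^(2n+2m+1); p)_∞).
--
-- With the weights w_m = c (1 - q) (-1)^m q^(m(m+2)) [N m]_p / (1 - q^(2m+1)), where
-- c = q / ((1 - q)(q; p)_(N+1)), the sum Σ_m w_m (R_m(n+1) - R_m(n)) factors as
-- c (1 - q)² q^(2n) (q^(2n+2); p)_∞ (q^(2n+2k); p)_∞ / (q^(2n+1); p)_∞² times a terminating
-- q-Chu–Vandermonde sum, which equals (q³; p)_N whatever n is.  As c (1 - q)² (q³; p)_N = q,
-- this is the n-th summand of F_{k,1}.  Summing over n telescopes to F_{k,1} = Σ_m w_m, the
-- right-hand side, because (q^(4-2k); p)_m q^((2k-1)m) = (-1)^m q^(m(m+2)) [N m]_p (p; p)_m.
-- Power series are coefficient functions, so "R_m(n) → 1" becomes agreement modulo q^(2n).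

module Submission where

open import Defs

open import Algebra.Bundles using (CommutativeRing)
import Algebra.Properties.CommutativeSemigroup as CommutativeSemigroupProperties
import Algebra.Solver.Ring as RingSolver
open import Algebra.Solver.Ring.AlmostCommutativeRing using (fromCommutativeRing; _-Raw-AlmostCommutative⟶_)
open import Data.Bool using (true; false; if_then_else_)
open import Data.Integer as ℤ using (ℤ; +_; -_; -[1+_])
import Data.Integer.Properties as ℤP
import Data.Integer.Tactic.RingSolver as ℤ-Solver
open import Data.List using ([]; _∷_; _++_; map; foldr; applyUpTo; upTo; zipWith)
import Data.List.Properties as ListP
open import Data.List.Relation.Unary.All.Properties using (applyUpTo⁺₁)
open import Data.Maybe using (Maybe; just; nothing)
open import Data.Nat as ℕ using (ℕ; zero; suc; _∸_; _≤_; _<_; z≤n; s≤s; NonZero)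
import Data.Nat.Properties as ℕP
import Data.Nat.Tactic.RingSolver as ℕ-Solver
open import Data.Product using (_×_; _,_)
open import Data.Sum using (_⊎_; inj₁; inj₂)
open import Function using (_∘_)
open import Function.Bundles using (_⇔_; mk⇔)
open import Level using (0ℓ)
open import Relation.Binary.PropositionalEquality using (_≡_; _≢_; refl; sym; trans; cong; cong₂; module ≡-Reasoning)
import Relation.Binary.Reasoning.Setoid as SetoidReasoning
open import Relation.Nullary using (yes; no; does)
open import Relation.Nullary.Decidable using (⌊_⌋; isYes≗does; dec-true; dec-false; does-⇔)

open CommutativeSemigroupProperties ℤP.+-commutativeSemigroup using (interchange; x∙yz≈y∙xz)

-- The ring of formal power series

infix 4 _≡_mod-q^_
_≡_mod-q^_ : PS → PS → ℕ → Set
f ≡ g mod-q^ L = ∀ m → m < L → f m ≡ g m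

0ₚ : PS
0ₚ _ = + 0

negₚ : PS → PS
negₚ f m = - f m

tail : PS → PS
tail f m = f (suc m)

infixr 8 _·ₚ_
_·ₚ_ : ℤ → PS → PS
(c ·ₚ f) m = c ℤ.* f m

coeff-*-applyUpTo : ∀ f g m →
  (f *ₚ g) m ≡ sumℤ (applyUpTo (λ i → f i ℤ.* g (m ∸ i)) (suc m))
coeff-*-applyUpTo f g m = cong sumℤ (ListP.map-upTo (λ i → f i ℤ.* g (m ∸ i)) (suc m))

coeff-*-zero : ∀ f g → (f *ₚ g) 0 ≡ f 0 ℤ.* g 0
coeff-*-zero f g = ℤP.+-identityʳ _

coeff-*-suc : ∀ f g m → (f *ₚ g) (suc m) ≡ f 0 ℤ.* g (suc m) ℤ.+ (tail f *ₚ g) m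
coeff-*-suc f g m = trans (coeff-*-applyUpTo f g (suc m))
  (cong (ℤ._+_ (f 0 ℤ.* g (suc m))) (sym (coeff-*-applyUpTo (tail f) g m)))

*ₚ-mod : ∀ {f f' g g' L} → f ≡ f' mod-q^ L → g ≡ g' mod-q^ L → f *ₚ g ≡ f' *ₚ g' mod-q^ L
*ₚ-mod {f} {f'} {g} {g'} f≡f' g≡g' m m<L =
  cong sumℤ (ListP.map-cong-local {f = λ i → f i ℤ.* g (m ∸ i)} (applyUpTo⁺₁ (λ i → i) (suc m) agree))
  where
  below : ∀ {i} → i ≤ m → i < _
  below i≤m = ℕP.≤-<-trans i≤m m<L
  agree : ∀ {i} → i < suc m → f i ℤ.* g (m ∸ i) ≡ f' i ℤ.* g' (m ∸ i)
  agree {i} (s≤s i≤m) = cong₂ ℤ._*_ (f≡f' i (below i≤m)) (g≡g' (m ∸ i) (below (ℕP.m∸n≤m m i)))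

*ₚ-cong : ∀ {f f' g g'} → f ≐ f' → g ≐ g' → f *ₚ g ≐ f' *ₚ g'
*ₚ-cong f≐f' g≐g' m = *ₚ-mod (λ i _ → f≐f' i) (λ i _ → g≐g' i) m (ℕP.n<1+n m)

*ₚ-zeroˡ : ∀ g → 0ₚ *ₚ g ≐ 0ₚ
*ₚ-zeroˡ g zero    = refl
*ₚ-zeroˡ g (suc m) = trans (coeff-*-suc 0ₚ g m) (trans (ℤP.+-identityˡ _) (*ₚ-zeroˡ g m))

*ₚ-identityˡ : ∀ f → 1ₚ *ₚ f ≐ f
*ₚ-identityˡ f zero    = trans (coeff-*-zero 1ₚ f) (ℤP.*-identityˡ (f 0))
*ₚ-identityˡ f (suc m) = trans (coeff-*-suc 1ₚ f m)
  (trans (cong₂ ℤ._+_ (ℤP.*-identityˡ (f (suc m))) (*ₚ-zeroˡ f m)) (ℤP.+-identityʳ _))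

·ₚ-*ₚ-assoc : ∀ c f g → (c ·ₚ f) *ₚ g ≐ c ·ₚ (f *ₚ g)
·ₚ-*ₚ-assoc c f g zero = begin
  ((c ·ₚ f) *ₚ g) 0        ≡⟨ coeff-*-zero (c ·ₚ f) g ⟩
  c ℤ.* f 0 ℤ.* g 0        ≡⟨ ℤP.*-assoc c (f 0) (g 0) ⟩
  c ℤ.* (f 0 ℤ.* g 0)      ≡⟨ cong (c ℤ.*_) (coeff-*-zero f g) ⟨
  (c ·ₚ (f *ₚ g)) 0        ∎
  where open ≡-Reasoning
·ₚ-*ₚ-assoc c f g (suc m) = begin
  ((c ·ₚ f) *ₚ g) (suc m)                               ≡⟨ coeff-*-suc (c ·ₚ f) g m ⟩
  c ℤ.* f 0 ℤ.* g (suc m) ℤ.+ ((c ·ₚ tail f) *ₚ g) m    ≡⟨ cong₂ ℤ._+_ (ℤP.*-assoc c (f 0) (g (suc m)))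
                                                                        (·ₚ-*ₚ-assoc c (tail f) g m) ⟩
  c ℤ.* (f 0 ℤ.* g (suc m)) ℤ.+ c ℤ.* (tail f *ₚ g) m   ≡⟨ ℤP.*-distribˡ-+ c _ _ ⟨
  c ℤ.* (f 0 ℤ.* g (suc m) ℤ.+ (tail f *ₚ g) m)         ≡⟨ cong (c ℤ.*_) (coeff-*-suc f g m) ⟨
  (c ·ₚ (f *ₚ g)) (suc m)                               ∎
  where open ≡-Reasoning

*ₚ-distribʳ : ∀ f g h → (f +ₚ g) *ₚ h ≐ f *ₚ h +ₚ g *ₚ h
*ₚ-distribʳ f g h zero = begin
  ((f +ₚ g) *ₚ h) 0                  ≡⟨ coeff-*-zero (f +ₚ g) h ⟩
  (f 0 ℤ.+ g 0) ℤ.* h 0              ≡⟨ ℤP.*-distribʳ-+ (h 0) (f 0) (g 0) ⟩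
  f 0 ℤ.* h 0 ℤ.+ g 0 ℤ.* h 0        ≡⟨ cong₂ ℤ._+_ (coeff-*-zero f h) (coeff-*-zero g h) ⟨
  (f *ₚ h +ₚ g *ₚ h) 0               ∎
  where open ≡-Reasoning
*ₚ-distribʳ f g h (suc m) = begin
  ((f +ₚ g) *ₚ h) (suc m)
    ≡⟨ coeff-*-suc (f +ₚ g) h m ⟩
  (f 0 ℤ.+ g 0) ℤ.* h (suc m) ℤ.+ ((tail f +ₚ tail g) *ₚ h) m
    ≡⟨ cong₂ ℤ._+_ (ℤP.*-distribʳ-+ (h (suc m)) (f 0) (g 0)) (*ₚ-distribʳ (tail f) (tail g) h m) ⟩
  (f 0 ℤ.* h (suc m) ℤ.+ g 0 ℤ.* h (suc m)) ℤ.+ ((tail f *ₚ h) m ℤ.+ (tail g *ₚ h) m)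
    ≡⟨ interchange (f 0 ℤ.* h (suc m)) (g 0 ℤ.* h (suc m)) ((tail f *ₚ h) m) ((tail g *ₚ h) m) ⟩
  (f 0 ℤ.* h (suc m) ℤ.+ (tail f *ₚ h) m) ℤ.+ (g 0 ℤ.* h (suc m) ℤ.+ (tail g *ₚ h) m)
    ≡⟨ cong₂ ℤ._+_ (coeff-*-suc f h m) (coeff-*-suc g h m) ⟨
  (f *ₚ h +ₚ g *ₚ h) (suc m)
    ∎
  where open ≡-Reasoning

*ₚ-assoc : ∀ f g h → (f *ₚ g) *ₚ h ≐ f *ₚ (g *ₚ h)
*ₚ-assoc f g h zero = begin
  ((f *ₚ g) *ₚ h) 0            ≡⟨ coeff-*-zero (f *ₚ g) h ⟩
  (f *ₚ g) 0 ℤ.* h 0           ≡⟨ cong (ℤ._* h 0) (coeff-*-zero f g) ⟩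
  f 0 ℤ.* g 0 ℤ.* h 0          ≡⟨ ℤP.*-assoc (f 0) (g 0) (h 0) ⟩
  f 0 ℤ.* (g 0 ℤ.* h 0)        ≡⟨ cong (f 0 ℤ.*_) (coeff-*-zero g h) ⟨
  f 0 ℤ.* (g *ₚ h) 0           ≡⟨ coeff-*-zero f (g *ₚ h) ⟨
  (f *ₚ (g *ₚ h)) 0            ∎
  where open ≡-Reasoning
*ₚ-assoc f g h (suc m) = begin
  ((f *ₚ g) *ₚ h) (suc m)
    ≡⟨ coeff-*-suc (f *ₚ g) h m ⟩
  (f *ₚ g) 0 ℤ.* h (suc m) ℤ.+ (tail (f *ₚ g) *ₚ h) m
    ≡⟨ cong₂ ℤ._+_ (cong (ℤ._* h (suc m)) (coeff-*-zero f g)) tail-product ⟩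
  f 0 ℤ.* g 0 ℤ.* h (suc m) ℤ.+ (f 0 ℤ.* (tail g *ₚ h) m ℤ.+ (tail f *ₚ (g *ₚ h)) m)
    ≡⟨ regroup (f 0) (g 0) (h (suc m)) ((tail g *ₚ h) m) ((tail f *ₚ (g *ₚ h)) m) ⟩
  f 0 ℤ.* (g 0 ℤ.* h (suc m) ℤ.+ (tail g *ₚ h) m) ℤ.+ (tail f *ₚ (g *ₚ h)) m
    ≡⟨ cong (λ x → f 0 ℤ.* x ℤ.+ (tail f *ₚ (g *ₚ h)) m) (coeff-*-suc g h m) ⟨
  f 0 ℤ.* (g *ₚ h) (suc m) ℤ.+ (tail f *ₚ (g *ₚ h)) m
    ≡⟨ coeff-*-suc f (g *ₚ h) m ⟨
  (f *ₚ (g *ₚ h)) (suc m)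
    ∎
  where
  open ≡-Reasoning
  tail-product : (tail (f *ₚ g) *ₚ h) m ≡ f 0 ℤ.* (tail g *ₚ h) m ℤ.+ (tail f *ₚ (g *ₚ h)) m
  tail-product = begin
    (tail (f *ₚ g) *ₚ h) m                       ≡⟨ *ₚ-cong {g = h} (coeff-*-suc f g) (λ _ → refl) m ⟩
    ((f 0 ·ₚ tail g +ₚ tail f *ₚ g) *ₚ h) m      ≡⟨ *ₚ-distribʳ (f 0 ·ₚ tail g) (tail f *ₚ g) h m ⟩
    ((f 0 ·ₚ tail g) *ₚ h) m ℤ.+ ((tail f *ₚ g) *ₚ h) m
      ≡⟨ cong₂ ℤ._+_ (·ₚ-*ₚ-assoc (f 0) (tail g) h m) (*ₚ-assoc (tail f) g h m) ⟩
    f 0 ℤ.* (tail g *ₚ h) m ℤ.+ (tail f *ₚ (g *ₚ h)) m ∎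
  regroup : ∀ a b c d e → a ℤ.* b ℤ.* c ℤ.+ (a ℤ.* d ℤ.+ e) ≡ a ℤ.* (b ℤ.* c ℤ.+ d) ℤ.+ e
  regroup = ℤ-Solver.solve-∀

*ₚ-comm : ∀ f g → f *ₚ g ≐ g *ₚ f
*ₚ-comm f g zero = begin
  (f *ₚ g) 0      ≡⟨ coeff-*-zero f g ⟩
  f 0 ℤ.* g 0     ≡⟨ ℤP.*-comm (f 0) (g 0) ⟩
  g 0 ℤ.* f 0     ≡⟨ coeff-*-zero g f ⟨
  (g *ₚ f) 0      ∎
  where open ≡-Reasoning
*ₚ-comm f g (suc zero) = begin
  (f *ₚ g) 1                          ≡⟨ coeff-*-suc f g 0 ⟩
  f 0 ℤ.* g 1 ℤ.+ (tail f *ₚ g) 0     ≡⟨ cong (ℤ._+_ (f 0 ℤ.* g 1)) (coeff-*-zero (tail f) g) ⟩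
  f 0 ℤ.* g 1 ℤ.+ f 1 ℤ.* g 0         ≡⟨ swap (f 0) (g 1) (f 1) (g 0) ⟩
  g 0 ℤ.* f 1 ℤ.+ g 1 ℤ.* f 0         ≡⟨ cong (ℤ._+_ (g 0 ℤ.* f 1)) (coeff-*-zero (tail g) f) ⟨
  g 0 ℤ.* f 1 ℤ.+ (tail g *ₚ f) 0     ≡⟨ coeff-*-suc g f 0 ⟨
  (g *ₚ f) 1                          ∎
  where
  open ≡-Reasoning
  swap : ∀ a b c d → a ℤ.* b ℤ.+ c ℤ.* d ≡ d ℤ.* c ℤ.+ b ℤ.* a
  swap = ℤ-Solver.solve-∀
*ₚ-comm f g (suc (suc m)) = begin
  (f *ₚ g) (suc (suc m))
    ≡⟨ coeff-*-suc f g (suc m) ⟩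
  f 0 ℤ.* g (suc (suc m)) ℤ.+ (tail f *ₚ g) (suc m)
    ≡⟨ cong (ℤ._+_ (f 0 ℤ.* g (suc (suc m)))) (trans (*ₚ-comm (tail f) g (suc m)) (coeff-*-suc g (tail f) m)) ⟩
  f 0 ℤ.* g (suc (suc m)) ℤ.+ (g 0 ℤ.* f (suc (suc m)) ℤ.+ (tail g *ₚ tail f) m)
    ≡⟨ cong (λ x → f 0 ℤ.* g (suc (suc m)) ℤ.+ (g 0 ℤ.* f (suc (suc m)) ℤ.+ x)) (*ₚ-comm (tail g) (tail f) m) ⟩
  f 0 ℤ.* g (suc (suc m)) ℤ.+ (g 0 ℤ.* f (suc (suc m)) ℤ.+ (tail f *ₚ tail g) m)
    ≡⟨ x∙yz≈y∙xz (f 0 ℤ.* g (suc (suc m))) (g 0 ℤ.* f (suc (suc m))) ((tail f *ₚ tail g) m) ⟩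
  g 0 ℤ.* f (suc (suc m)) ℤ.+ (f 0 ℤ.* g (suc (suc m)) ℤ.+ (tail f *ₚ tail g) m)
    ≡⟨ cong (ℤ._+_ (g 0 ℤ.* f (suc (suc m)))) (trans (*ₚ-comm (tail g) f (suc m)) (coeff-*-suc f (tail g) m)) ⟨
  g 0 ℤ.* f (suc (suc m)) ℤ.+ (tail g *ₚ f) (suc m)
    ≡⟨ coeff-*-suc g f (suc m) ⟨
  (g *ₚ f) (suc (suc m))
    ∎
  where open ≡-Reasoning

powerSeriesRing : CommutativeRing 0ℓ 0ℓ
powerSeriesRing = record
  { Carrier = PS ; _≈_ = _≐_ ; _+_ = _+ₚ_ ; _*_ = _*ₚ_ ; -_ = negₚ ; 0# = 0ₚ ; 1# = 1ₚ
  ; isCommutativeRing = record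
    { isRing = record
      { +-isAbelianGroup = record
        { isGroup = record
          { isMonoid = record
            { isSemigroup = record
              { isMagma = record
                { isEquivalence = record
                  { refl  = λ _ → refl
                  ; sym   = λ f≐g m → sym (f≐g m)
                  ; trans = λ f≐g g≐h m → trans (f≐g m) (g≐h m) }
                ; ∙-cong = λ f≐f' g≐g' m → cong₂ ℤ._+_ (f≐f' m) (g≐g' m) }
              ; assoc = λ f g h m → ℤP.+-assoc (f m) (g m) (h m) }
            ; identity = (λ f m → ℤP.+-identityˡ (f m)) , (λ f m → ℤP.+-identityʳ (f m)) }
          ; inverse = (λ f m → ℤP.+-inverseˡ (f m)) , (λ f m → ℤP.+-inverseʳ (f m))
          ; ⁻¹-cong = λ f≐g m → cong -_ (f≐g m) }
        ; comm = λ f g m → ℤP.+-comm (f m) (g m) }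
      ; *-cong = *ₚ-cong
      ; *-assoc = *ₚ-assoc
      ; *-identity = *ₚ-identityˡ , λ f m → trans (*ₚ-comm f 1ₚ m) (*ₚ-identityˡ f m)
      ; distrib = (λ f g h m → begin
                      (f *ₚ (g +ₚ h)) m            ≡⟨ *ₚ-comm f (g +ₚ h) m ⟩
                      ((g +ₚ h) *ₚ f) m            ≡⟨ *ₚ-distribʳ g h f m ⟩
                      (g *ₚ f +ₚ h *ₚ f) m         ≡⟨ cong₂ ℤ._+_ (*ₚ-comm g f m) (*ₚ-comm h f m) ⟩
                      (f *ₚ g +ₚ f *ₚ h) m         ∎)
                , (λ f g h → *ₚ-distribʳ g h f) }
    ; *-comm = *ₚ-comm } }
  where open ≡-Reasoning

open CommutativeRing powerSeriesRing public
  using ( setoid; +-cong; +-congˡ; +-congʳ; *-cong; *-congˡ; *-congʳ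
        ; +-identityˡ; +-identityʳ; +-assoc; *-assoc; *-comm; *-identityˡ; *-identityʳ
        ; distribˡ; distribʳ; zeroˡ; zeroʳ; -‿cong)
  renaming (refl to ≈-refl; sym to ≈-sym; trans to ≈-trans; reflexive to ≈-reflexive)

module ≈-Reasoning = SetoidReasoning setoid
module *-CS = CommutativeSemigroupProperties (CommutativeRing.*-commutativeSemigroup powerSeriesRing)

*ₚ-≡1 : ∀ {f g L} → f ≡ 1ₚ mod-q^ L → g ≡ 1ₚ mod-q^ L → f *ₚ g ≡ 1ₚ mod-q^ L
*ₚ-≡1 f≡1 g≡1 m m<L = trans (*ₚ-mod f≡1 g≡1 m m<L) (*-identityˡ 1ₚ m)

mod-q^-weaken : ∀ {f g L L'} → L ≤ L' → f ≡ g mod-q^ L' → f ≡ g mod-q^ L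
mod-q^-weaken L≤L' f≡g m m<L = f≡g m (ℕP.<-≤-trans m<L L≤L')

constₚ : ℤ → PS
constₚ c = c ·ₚ 1ₚ

ℤ⟶PS : ℤ.+-*-rawRing -Raw-AlmostCommutative⟶ fromCommutativeRing powerSeriesRing
ℤ⟶PS = record
  { ⟦_⟧    = constₚ
  ; +-homo = λ c d m → ℤP.*-distribʳ-+ (1ₚ m) c d
  ; *-homo = λ c d m → begin
      c ℤ.* d ℤ.* 1ₚ m                     ≡⟨ ℤP.*-assoc c d (1ₚ m) ⟩
      c ℤ.* (d ℤ.* 1ₚ m)                   ≡⟨ cong (c ℤ.*_) (*ₚ-identityˡ (constₚ d) m) ⟨
      c ℤ.* (1ₚ *ₚ constₚ d) m             ≡⟨ ·ₚ-*ₚ-assoc c 1ₚ (constₚ d) m ⟨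
      (constₚ c *ₚ constₚ d) m             ∎
  ; -‿homo = λ c m → sym (ℤP.neg-distribˡ-* c (1ₚ m))
  ; 0-homo = λ m → ℤP.*-zeroˡ (1ₚ m)
  ; 1-homo = λ m → ℤP.*-identityˡ (1ₚ m) }
  where open ≡-Reasoning

constₚ-≟ : ∀ c d → Maybe (constₚ c ≐ constₚ d)
constₚ-≟ c d with c ℤ.≟ d
... | yes refl = just ≈-refl
... | no _     = nothing

module Solver = RingSolver ℤ.+-*-rawRing (fromCommutativeRing powerSeriesRing) ℤ⟶PS constₚ-≟

-- ⟦ con (+ 1) ⟧ is + 1 ·ₚ 1ₚ, whereas the empty power ⟦ p :^ 0 ⟧ is 1ₚ itself, so that
-- 1-q^ a = 1ₚ -ₚ X^ a matches solver statements definitionally.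
:1 : ∀ {n} → Solver.Polynomial n
:1 = Solver.con (+ 1) Solver.:^ 0

-- Monomials

shift : ℕ → PS → PS
shift zero    f         = f
shift (suc a) f zero    = + 0
shift (suc a) f (suc m) = shift a f m

X^-zero : X^ 0 ≐ 1ₚ
X^-zero zero    = refl
X^-zero (suc m) = refl

X^-diagonal : ∀ a → X^ a a ≡ + 1
X^-diagonal a =
  cong (λ b → if b then + 1 else + 0) (trans (isYes≗does (a ℕ.≟ a)) (dec-true (a ℕ.≟ a) refl))

X^-off-diagonal : ∀ {a m} → a ≢ m → X^ a m ≡ + 0
X^-off-diagonal {a} {m} a≢m =
  cong (λ b → if b then + 1 else + 0) (trans (isYes≗does (a ℕ.≟ m)) (dec-false (a ℕ.≟ m) a≢m))

X^-suc-zero : ∀ a → X^ (suc a) 0 ≡ + 0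
X^-suc-zero a = X^-off-diagonal {suc a} {0} (λ ())

X^-suc : ∀ a m → X^ (suc a) (suc m) ≡ X^ a m
X^-suc a m with a ℕ.≟ m
... | yes refl = X^-diagonal (suc a)
... | no a≢m   = X^-off-diagonal (a≢m ∘ ℕP.suc-injective)

X^-*ₚ-shift : ∀ a f → X^ a *ₚ f ≐ shift a f
X^-*ₚ-shift zero    f         = ≈-trans (*-congʳ {f} X^-zero) (*-identityˡ f)
X^-*ₚ-shift (suc a) f zero    = trans (coeff-*-zero (X^ (suc a)) f) (cong (ℤ._* f 0) (X^-suc-zero a))
X^-*ₚ-shift (suc a) f (suc m) = begin
  (X^ (suc a) *ₚ f) (suc m)                           ≡⟨ coeff-*-suc (X^ (suc a)) f m ⟩
  X^ (suc a) 0 ℤ.* f (suc m) ℤ.+ (tail (X^ (suc a)) *ₚ f) m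
    ≡⟨ cong₂ ℤ._+_ (cong (ℤ._* f (suc m)) (X^-suc-zero a)) (*ₚ-cong {g = f} (X^-suc a) (λ _ → refl) m) ⟩
  + 0 ℤ.+ (X^ a *ₚ f) m                               ≡⟨ ℤP.+-identityˡ _ ⟩
  (X^ a *ₚ f) m                                       ≡⟨ X^-*ₚ-shift a f m ⟩
  shift a f m                                         ∎
  where open ≡-Reasoning

shift-X^ : ∀ a b → shift a (X^ b) ≐ X^ (a ℕ.+ b)
shift-X^ zero    b m       = refl
shift-X^ (suc a) b zero    = sym (X^-suc-zero (a ℕ.+ b))
shift-X^ (suc a) b (suc m) = trans (shift-X^ a b m) (sym (X^-suc (a ℕ.+ b) m))

X^-+ : ∀ a b → X^ a *ₚ X^ b ≐ X^ (a ℕ.+ b)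
X^-+ a b = ≈-trans (X^-*ₚ-shift a (X^ b)) (shift-X^ a b)

X^-cong : ∀ {a b} → a ≡ b → X^ a ≐ X^ b
X^-cong refl = ≈-refl

1-q^-cong : ∀ {a b} → a ≡ b → 1-q^ a ≐ 1-q^ b
1-q^-cong refl = ≈-refl

1-q^-zero : 1-q^ 0 ≐ 0ₚ
1-q^-zero zero    = refl
1-q^-zero (suc m) = refl

1-q^-≡1 : ∀ a → 1-q^ a ≡ 1ₚ mod-q^ a
1-q^-≡1 a m m<a =
  trans (cong (ℤ._-_ (1ₚ m)) (X^-off-diagonal (λ a≡m → ℕP.<⇒≢ m<a (sym a≡m)))) (ℤP.+-identityʳ (1ₚ m))

1-q^-+ : ∀ a b → 1-q^ (a ℕ.+ b) ≐ 1ₚ -ₚ X^ a *ₚ X^ b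
1-q^-+ a b = +-congˡ {1ₚ} (-‿cong (≈-sym (X^-+ a b)))

-- Multiplicative inverses

*-const≡1 : ∀ f g → f 0 ≡ + 1 → g 0 ≡ + 1 → (f *ₚ g) 0 ≡ + 1
*-const≡1 f g f₀≡1 g₀≡1 = trans (coeff-*-zero f g) (cong₂ ℤ._*_ f₀≡1 g₀≡1)

zipWith-applyUpTo : ∀ {A B C : Set} (_∙_ : A → B → C) a b n →
  zipWith _∙_ (applyUpTo a n) (applyUpTo b n) ≡ applyUpTo (λ i → a i ∙ b i) n
zipWith-applyUpTo _∙_ a b zero    = refl
zipWith-applyUpTo _∙_ a b (suc n) = cong (a 0 ∙ b 0 ∷_) (zipWith-applyUpTo _∙_ (a ∘ suc) (b ∘ suc) n)

invList-applyUpTo : ∀ f m → invList f m ≡ applyUpTo (λ i → inv f (m ∸ i)) (suc m)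
invList-applyUpTo f zero    = refl
invList-applyUpTo f (suc m) = cong (inv f (suc m) ∷_) (invList-applyUpTo f m)

map-range-1 : ∀ {A : Set} (g : ℕ → A) n → map g (range 1 n) ≡ applyUpTo (g ∘ suc) n
map-range-1 g n = trans (cong (map g) (ListP.map-upTo suc n)) (ListP.map-applyUpTo suc g n)

coeff-inv-suc : ∀ f m → inv f (suc m) ≡ - (tail f *ₚ inv f) m
coeff-inv-suc f m = cong (λ xs → - sumℤ xs) (begin
  zipWith ℤ._*_ (map f (range 1 (suc m))) (invList f m)
    ≡⟨ cong₂ (zipWith ℤ._*_) (map-range-1 f (suc m)) (invList-applyUpTo f m) ⟩
  zipWith ℤ._*_ (applyUpTo (tail f) (suc m)) (applyUpTo (λ i → inv f (m ∸ i)) (suc m))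
    ≡⟨ zipWith-applyUpTo ℤ._*_ (tail f) (λ i → inv f (m ∸ i)) (suc m) ⟩
  applyUpTo (λ i → tail f i ℤ.* inv f (m ∸ i)) (suc m)
    ≡⟨ ListP.map-upTo (λ i → tail f i ℤ.* inv f (m ∸ i)) (suc m) ⟨
  map (λ i → tail f i ℤ.* inv f (m ∸ i)) (upTo (suc m))
    ∎)
  where open ≡-Reasoning

*-inverseʳ : ∀ f → f 0 ≡ + 1 → f *ₚ inv f ≐ 1ₚ
*-inverseʳ f f₀≡1 zero    = trans (coeff-*-zero f (inv f)) (cong (ℤ._* + 1) f₀≡1)
*-inverseʳ f f₀≡1 (suc m) = begin
  (f *ₚ inv f) (suc m)                        ≡⟨ coeff-*-suc f (inv f) m ⟩
  f 0 ℤ.* inv f (suc m) ℤ.+ t                 ≡⟨ cong₂ (λ a b → a ℤ.* b ℤ.+ t) f₀≡1 (coeff-inv-suc f m) ⟩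
  + 1 ℤ.* (- t) ℤ.+ t                         ≡⟨ cong (ℤ._+ t) (ℤP.*-identityˡ (- t)) ⟩
  - t ℤ.+ t                                   ≡⟨ ℤP.+-inverseˡ t ⟩
  + 0                                         ∎
  where
  open ≡-Reasoning
  t = (tail f *ₚ inv f) m

inv-unique : ∀ {f g} → f 0 ≡ + 1 → f *ₚ g ≐ 1ₚ → g ≐ inv f
inv-unique {f} {g} f₀≡1 fg≐1 = begin
  g                     ≈⟨ *-identityʳ g ⟨
  g *ₚ 1ₚ               ≈⟨ *-congˡ {g} (*-inverseʳ f f₀≡1) ⟨
  g *ₚ (f *ₚ inv f)     ≈⟨ *-assoc g f (inv f) ⟨
  (g *ₚ f) *ₚ inv f     ≈⟨ *-congʳ {inv f} (≈-trans (*-comm g f) fg≐1) ⟩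
  1ₚ *ₚ inv f           ≈⟨ *-identityˡ (inv f) ⟩
  inv f                 ∎
  where open ≈-Reasoning

inv-* : ∀ {f g} → f 0 ≡ + 1 → g 0 ≡ + 1 → inv (f *ₚ g) ≐ inv f *ₚ inv g
inv-* {f} {g} f₀≡1 g₀≡1 = ≈-sym (inv-unique (*-const≡1 f g f₀≡1 g₀≡1) (begin
  (f *ₚ g) *ₚ (inv f *ₚ inv g)       ≈⟨ *-CS.interchange f g (inv f) (inv g) ⟩
  (f *ₚ inv f) *ₚ (g *ₚ inv g)       ≈⟨ *-cong (*-inverseʳ f f₀≡1) (*-inverseʳ g g₀≡1) ⟩
  1ₚ *ₚ 1ₚ                           ≈⟨ *-identityˡ 1ₚ ⟩
  1ₚ                                 ∎))
  where open ≈-Reasoning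

inv-≡1 : ∀ {f L} → f 0 ≡ + 1 → f ≡ 1ₚ mod-q^ L → inv f ≡ 1ₚ mod-q^ L
inv-≡1 {f} f₀≡1 f≡1 m m<L = begin
  inv f m                ≡⟨ *-identityˡ (inv f) m ⟨
  (1ₚ *ₚ inv f) m        ≡⟨ *ₚ-mod {g = inv f} (λ i i<L → sym (f≡1 i i<L)) (λ _ _ → refl) m m<L ⟩
  (f *ₚ inv f) m         ≡⟨ *-inverseʳ f f₀≡1 m ⟩
  1ₚ m                   ∎
  where open ≡-Reasoning

inv-factor : ∀ {f g} u → g 0 ≡ + 1 → f 0 ≡ + 1 → f ≐ u *ₚ g → inv g ≐ u *ₚ inv f
inv-factor {f} {g} u g₀≡1 f₀≡1 f≐ug = ≈-sym (inv-unique g₀≡1 (begin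
  g *ₚ (u *ₚ inv f)      ≈⟨ *-assoc g u (inv f) ⟨
  g *ₚ u *ₚ inv f        ≈⟨ *-congʳ {inv f} (≈-trans (*-comm g u) (≈-sym f≐ug)) ⟩
  f *ₚ inv f             ≈⟨ *-inverseʳ f f₀≡1 ⟩
  1ₚ                     ∎))
  where open ≈-Reasoning

-- Finite sums and products

∏ : ℕ → (ℕ → PS) → PS
∏ n f = prodₚ (applyUpTo f n)

∑ : ℕ → (ℕ → PS) → PS
∑ n f = sumₚ (applyUpTo f n)

∏-cong : ∀ n {f g} → (∀ j → j < n → f j ≐ g j) → ∏ n f ≐ ∏ n g
∏-cong zero    f≐g = ≈-refl
∏-cong (suc n) f≐g = *-cong (f≐g 0 (s≤s z≤n)) (∏-cong n (λ j j<n → f≐g (suc j) (s≤s j<n)))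

∏-suc : ∀ n f → ∏ (suc n) f ≐ ∏ n f *ₚ f n
∏-suc zero    f = *-comm (f 0) 1ₚ
∏-suc (suc n) f = ≈-trans (*-congˡ {f 0} (∏-suc n (f ∘ suc))) (≈-sym (*-assoc (f 0) _ (f (suc n))))

∏-+ : ∀ m n f → ∏ (m ℕ.+ n) f ≐ ∏ m f *ₚ ∏ n (λ j → f (m ℕ.+ j))
∏-+ zero    n f = ≈-sym (*-identityˡ (∏ n f))
∏-+ (suc m) n f = ≈-trans (*-congˡ {f 0} (∏-+ m n (f ∘ suc))) (≈-sym (*-assoc (f 0) _ _))

∏-* : ∀ n f g → ∏ n (λ j → f j *ₚ g j) ≐ ∏ n f *ₚ ∏ n g
∏-* zero    f g = ≈-sym (*-identityˡ 1ₚ)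
∏-* (suc n) f g = ≈-trans (*-congˡ {f 0 *ₚ g 0} (∏-* n (f ∘ suc) (g ∘ suc)))
                          (*-CS.interchange (f 0) (g 0) (∏ n (f ∘ suc)) (∏ n (g ∘ suc)))

∏-≡1 : ∀ n {f L} → (∀ j → f j ≡ 1ₚ mod-q^ L) → ∏ n f ≡ 1ₚ mod-q^ L
∏-≡1 zero    f≡1 m m<L = refl
∏-≡1 (suc n) f≡1       = *ₚ-≡1 (f≡1 0) (∏-≡1 n (λ j → f≡1 (suc j)))

∑-cong : ∀ n {f g} → (∀ j → j < n → f j ≐ g j) → ∑ n f ≐ ∑ n g
∑-cong zero    f≐g = ≈-refl
∑-cong (suc n) f≐g = +-cong (f≐g 0 (s≤s z≤n)) (∑-cong n (λ j j<n → f≐g (suc j) (s≤s j<n)))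

∑-mod : ∀ n {f g L} → (∀ j → j < n → f j ≡ g j mod-q^ L) → ∑ n f ≡ ∑ n g mod-q^ L
∑-mod zero    f≡g m m<L = refl
∑-mod (suc n) f≡g m m<L =
  cong₂ ℤ._+_ (f≡g 0 (s≤s z≤n) m m<L) (∑-mod n (λ j j<n → f≡g (suc j) (s≤s j<n)) m m<L)

∑-suc : ∀ n f → ∑ (suc n) f ≐ ∑ n f +ₚ f n
∑-suc zero    f m = ℤP.+-comm (f 0 m) (+ 0)
∑-suc (suc n) f m = trans (cong (ℤ._+_ (f 0 m)) (∑-suc n (f ∘ suc) m)) (sym (ℤP.+-assoc (f 0 m) _ _))

∑-+ : ∀ n f g → ∑ n (λ j → f j +ₚ g j) ≐ ∑ n f +ₚ ∑ n g
∑-+ zero    f g m = refl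
∑-+ (suc n) f g m = trans (cong (ℤ._+_ (f 0 m ℤ.+ g 0 m)) (∑-+ n (f ∘ suc) (g ∘ suc) m))
                          (interchange (f 0 m) (g 0 m) (∑ n (f ∘ suc) m) (∑ n (g ∘ suc) m))

∑-difference : ∀ n f g → ∑ n f -ₚ ∑ n g ≐ ∑ n (λ j → f j -ₚ g j)
∑-difference zero    f g m = refl
∑-difference (suc n) f g   = ≈-trans (difference-interchange (f 0) (∑ n (f ∘ suc)) (g 0) (∑ n (g ∘ suc)))
                            (+-congˡ {f 0 -ₚ g 0} (∑-difference n (f ∘ suc) (g ∘ suc)))
  where
  open Solver
  difference-interchange : ∀ a A b B → (a +ₚ A) -ₚ (b +ₚ B) ≐ (a -ₚ b) +ₚ (A -ₚ B)
  difference-interchange = solve 4 (λ a A b B → (a :+ A) :- (b :+ B) := (a :- b) :+ (A :- B)) ≈-refl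

∑-zero : ∀ n {f} → (∀ j → j < n → f j ≐ 0ₚ) → ∑ n f ≐ 0ₚ
∑-zero zero    f≐0 = ≈-refl
∑-zero (suc n) f≐0 = ≈-trans (+-cong (f≐0 0 (s≤s z≤n)) (∑-zero n (λ j j<n → f≐0 (suc j) (s≤s j<n)))) (+-identityˡ 0ₚ)

*-distribˡ-∑ : ∀ c n f → c *ₚ ∑ n f ≐ ∑ n (λ j → c *ₚ f j)
*-distribˡ-∑ c zero    f = zeroʳ c
*-distribˡ-∑ c (suc n) f = ≈-trans (distribˡ c (f 0) (∑ n (f ∘ suc))) (+-congˡ {c *ₚ f 0} (*-distribˡ-∑ c n (f ∘ suc)))

∑-telescope : ∀ n (f : ℕ → PS) → ∑ n (λ j → f (suc j) -ₚ f j) ≐ f n -ₚ f 0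
∑-telescope zero    f m = sym (ℤP.+-inverseʳ (f 0 m))
∑-telescope (suc n) f   = begin
  (f 1 -ₚ f 0) +ₚ ∑ n (λ j → f (2 ℕ.+ j) -ₚ f (suc j))  ≈⟨ +-congˡ {f 1 -ₚ f 0} (∑-telescope n (f ∘ suc)) ⟩
  (f 1 -ₚ f 0) +ₚ (f (suc n) -ₚ f 1)                  ≈⟨ cancel (f 0) (f 1) (f (suc n)) ⟩
  f (suc n) -ₚ f 0                                    ∎
  where
  open ≈-Reasoning
  open Solver
  cancel : ∀ a b c → (b -ₚ a) +ₚ (c -ₚ b) ≐ c -ₚ a
  cancel = solve 3 (λ a b c → (b :- a) :+ (c :- b) := c :- a) ≈-refl

sum∞-∑ : ∀ t m → sum∞ t m ≡ ∑ (suc m) t m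
sum∞-∑ t m = trans (cong sumℤ (ListP.map-upTo (λ n → t n m) (suc m))) (coeff-sumₚ (suc m) t)
  where
  coeff-sumₚ : ∀ k t → sumℤ (applyUpTo (λ n → t n m) k) ≡ ∑ k t m
  coeff-sumₚ zero    t = refl
  coeff-sumₚ (suc k) t = cong (ℤ._+_ (t 0 m)) (coeff-sumₚ k (t ∘ suc))

-- q-Pochhammer symbols

poch-∏ : ∀ a d n → poch a d n ≐ ∏ n (λ j → 1-q^ (a ℕ.+ d ℕ.* j))
poch-∏ a d n m = cong (λ fs → prodₚ fs m) (ListP.map-upTo (λ j → 1-q^ (a ℕ.+ d ℕ.* j)) n)

poch-suc : ∀ a d n → poch a d (suc n) ≐ 1-q^ a *ₚ poch (a ℕ.+ d) d n
poch-suc a d n = begin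
  poch a d (suc n)                                          ≈⟨ poch-∏ a d (suc n) ⟩
  1-q^ (a ℕ.+ d ℕ.* 0) *ₚ ∏ n (λ j → 1-q^ (a ℕ.+ d ℕ.* suc j))
    ≈⟨ *-cong (1-q^-cong (arith₀ a d)) (∏-cong n (λ j _ → 1-q^-cong (arith₁ a d j))) ⟩
  1-q^ a *ₚ ∏ n (λ j → 1-q^ (a ℕ.+ d ℕ.+ d ℕ.* j))          ≈⟨ *-congˡ {1-q^ a} (poch-∏ (a ℕ.+ d) d n) ⟨
  1-q^ a *ₚ poch (a ℕ.+ d) d n                              ∎
  where
  open ≈-Reasoning
  arith₀ : ∀ a d → a ℕ.+ d ℕ.* 0 ≡ a
  arith₀ = ℕ-Solver.solve-∀
  arith₁ : ∀ a d j → a ℕ.+ d ℕ.* suc j ≡ a ℕ.+ d ℕ.+ d ℕ.* j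
  arith₁ = ℕ-Solver.solve-∀

poch-+ : ∀ a d m n → poch a d (m ℕ.+ n) ≐ poch a d m *ₚ poch (a ℕ.+ d ℕ.* m) d n
poch-+ a d m n = begin
  poch a d (m ℕ.+ n)                                          ≈⟨ poch-∏ a d (m ℕ.+ n) ⟩
  ∏ (m ℕ.+ n) (λ j → 1-q^ (a ℕ.+ d ℕ.* j))                    ≈⟨ ∏-+ m n (λ j → 1-q^ (a ℕ.+ d ℕ.* j)) ⟩
  ∏ m (λ j → 1-q^ (a ℕ.+ d ℕ.* j)) *ₚ ∏ n (λ j → 1-q^ (a ℕ.+ d ℕ.* (m ℕ.+ j)))
    ≈⟨ *-cong (≈-sym (poch-∏ a d m)) (∏-cong n (λ j _ → 1-q^-cong (arith a d m j))) ⟩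
  poch a d m *ₚ ∏ n (λ j → 1-q^ (a ℕ.+ d ℕ.* m ℕ.+ d ℕ.* j))   ≈⟨ *-congˡ {poch a d m} (poch-∏ (a ℕ.+ d ℕ.* m) d n) ⟨
  poch a d m *ₚ poch (a ℕ.+ d ℕ.* m) d n                      ∎
  where
  open ≈-Reasoning
  arith : ∀ a d m j → a ℕ.+ d ℕ.* (m ℕ.+ j) ≡ a ℕ.+ d ℕ.* m ℕ.+ d ℕ.* j
  arith = ℕ-Solver.solve-∀

poch-≡1 : ∀ a d n → poch a d n ≡ 1ₚ mod-q^ a
poch-≡1 a d n m m<a = trans (poch-∏ a d n m)
  (∏-≡1 n (λ j → mod-q^-weaken (ℕP.m≤m+n a (d ℕ.* j)) (1-q^-≡1 (a ℕ.+ d ℕ.* j))) m m<a)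

poch∞-≡1 : ∀ a d → poch∞ a d ≡ 1ₚ mod-q^ a
poch∞-≡1 a d m = poch-≡1 a d (suc m) m

-- Factors beyond the m-th are 1 + O(q^(m+1)) because d ≥ 1.
poch∞-≡-poch : ∀ a d .{{_ : NonZero d}} n → poch∞ a d ≡ poch a d n mod-q^ n
poch∞-≡-poch a d n m m<n = begin
  poch a d (suc m) m                                           ≡⟨ *-identityʳ (poch a d (suc m)) m ⟨
  (poch a d (suc m) *ₚ 1ₚ) m
    ≡⟨ *ₚ-mod {poch a d (suc m)} (λ _ _ → refl) (λ i i≤m → sym (poch-≡1 (a ℕ.+ d ℕ.* suc m) d k i (far i≤m))) m ℕP.≤-refl ⟩
  (poch a d (suc m) *ₚ poch (a ℕ.+ d ℕ.* suc m) d k) m           ≡⟨ poch-+ a d (suc m) k m ⟨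
  poch a d (suc m ℕ.+ k) m                                     ≡⟨ cong (λ l → poch a d l m) (ℕP.m+[n∸m]≡n m<n) ⟩
  poch a d n m                                                 ∎
  where
  open ≡-Reasoning
  k = n ∸ suc m
  far : ∀ {i} → i < suc m → i < a ℕ.+ d ℕ.* suc m
  far i<1+m = ℕP.<-≤-trans i<1+m (ℕP.≤-trans (ℕP.m≤n*m (suc m) d) (ℕP.m≤n+m (d ℕ.* suc m) a))

poch∞-split : ∀ a d .{{_ : NonZero d}} n → poch∞ a d ≐ poch a d n *ₚ poch∞ (a ℕ.+ d ℕ.* n) d
poch∞-split a d n m = begin
  poch∞ a d m                                                  ≡⟨ poch∞-≡-poch a d (n ℕ.+ suc m) m (ℕP.m≤n+m (suc m) n) ⟩
  poch a d (n ℕ.+ suc m) m                                     ≡⟨ poch-+ a d n (suc m) m ⟩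
  (poch a d n *ₚ poch (a ℕ.+ d ℕ.* n) d (suc m)) m
    ≡⟨ *ₚ-mod {poch a d n} (λ _ _ → refl) (λ i i≤m → sym (poch∞-≡-poch (a ℕ.+ d ℕ.* n) d (suc m) i i≤m)) m ℕP.≤-refl ⟩
  (poch a d n *ₚ poch∞ (a ℕ.+ d ℕ.* n) d) m                    ∎
  where open ≡-Reasoning

poch∞-cong : ∀ {a b} d → a ≡ b → poch∞ a d ≐ poch∞ b d
poch∞-cong d refl = ≈-refl

poch∞-suc : ∀ a d .{{_ : NonZero d}} → poch∞ a d ≐ 1-q^ a *ₚ poch∞ (a ℕ.+ d) d
poch∞-suc a d = begin
  poch∞ a d                                           ≈⟨ poch∞-split a d 1 ⟩
  poch a d 1 *ₚ poch∞ (a ℕ.+ d ℕ.* 1) d               ≈⟨ *-cong (≈-trans (poch-suc a d 0) (*-identityʳ (1-q^ a)))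
                                                                (poch∞-cong d (cong (a ℕ.+_) (ℕP.*-identityʳ d))) ⟩
  1-q^ a *ₚ poch∞ (a ℕ.+ d) d                         ∎
  where open ≈-Reasoning

poch∞-zero : ∀ d .{{_ : NonZero d}} → poch∞ 0 d ≐ 0ₚ
poch∞-zero d = ≈-trans (poch∞-suc 0 d) (≈-trans (*-congʳ {poch∞ d d} 1-q^-zero) (zeroˡ (poch∞ d d)))

poch-suc-top : ∀ a d n → poch a d (suc n) ≐ poch a d n *ₚ 1-q^ (a ℕ.+ d ℕ.* n)
poch-suc-top a d n = begin
  poch a d (suc n)                                     ≡⟨ cong (poch a d) (ℕP.+-comm 1 n) ⟩
  poch a d (n ℕ.+ 1)                                   ≈⟨ poch-+ a d n 1 ⟩
  poch a d n *ₚ poch (a ℕ.+ d ℕ.* n) d 1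
    ≈⟨ *-congˡ {poch a d n} (≈-trans (poch-suc (a ℕ.+ d ℕ.* n) d 0) (*-identityʳ (1-q^ (a ℕ.+ d ℕ.* n)))) ⟩
  poch a d n *ₚ 1-q^ (a ℕ.+ d ℕ.* n)                   ∎
  where open ≈-Reasoning

-- Gaussian binomials and the q-Chu–Vandermonde sum

qBinomial : ℕ → ℕ → ℕ → PS
qBinomial d N       zero    = 1ₚ
qBinomial d zero    (suc m) = 0ₚ
qBinomial d (suc N) (suc m) = qBinomial d N (suc m) +ₚ X^ (d ℕ.* (N ∸ m)) *ₚ qBinomial d N m

qFalling : ℕ → ℕ → ℕ → PS
qFalling d N m = ∏ m (λ j → 1-q^ (d ℕ.* (N ∸ j)))

qBinomial-above : ∀ d {N m} → N < m → qBinomial d N m ≐ 0ₚ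
qBinomial-above d {zero}  {suc m} _         = ≈-refl
qBinomial-above d {suc N} {suc m} (s≤s N<m) = begin
  qBinomial d N (suc m) +ₚ X^ (d ℕ.* (N ∸ m)) *ₚ qBinomial d N m
    ≈⟨ +-cong (qBinomial-above d (ℕP.m<n⇒m<1+n N<m)) (*-congˡ {X^ (d ℕ.* (N ∸ m))} (qBinomial-above d N<m)) ⟩
  0ₚ +ₚ X^ (d ℕ.* (N ∸ m)) *ₚ 0ₚ
    ≈⟨ ≈-trans (+-identityˡ (X^ (d ℕ.* (N ∸ m)) *ₚ 0ₚ)) (zeroʳ (X^ (d ℕ.* (N ∸ m)))) ⟩
  0ₚ ∎
  where open ≈-Reasoning

qFalling-above : ∀ d {N m} → N < m → qFalling d N m ≐ 0ₚ
qFalling-above d {N} {suc m} (s≤s N≤m) = ≈-trans (∏-suc m (λ j → 1-q^ (d ℕ.* (N ∸ j)))) (vanishing (ℕP.m≤n⇒m<n∨m≡n N≤m))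
  where
  vanishing : N < m ⊎ N ≡ m → qFalling d N m *ₚ 1-q^ (d ℕ.* (N ∸ m)) ≐ 0ₚ
  vanishing (inj₁ N<m)  = ≈-trans (*-congʳ {1-q^ (d ℕ.* (N ∸ m))} (qFalling-above d N<m)) (zeroˡ (1-q^ (d ℕ.* (N ∸ m))))
  vanishing (inj₂ refl) = ≈-trans (*-congˡ {qFalling d N N} (≈-trans (1-q^-cong d[N∸N]≡0) 1-q^-zero)) (zeroʳ (qFalling d N N))
    where
    d[N∸N]≡0 : d ℕ.* (N ∸ N) ≡ 0
    d[N∸N]≡0 = trans (cong (d ℕ.*_) (ℕP.n∸n≡0 N)) (ℕP.*-zeroʳ d)

qBinomial-poch : ∀ d N m → qBinomial d N m *ₚ poch d d m ≐ qFalling d N m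
qBinomial-poch d N       zero    = *-identityˡ 1ₚ
qBinomial-poch d zero    (suc m) = ≈-trans (zeroˡ (poch d d (suc m))) (≈-sym (qFalling-above d {0} {suc m} (s≤s z≤n)))
qBinomial-poch d (suc N) (suc m) with ℕP.<-≤-connex N m
... | inj₁ N<m = ≈-trans (≈-trans (*-congʳ {poch d d (suc m)} (qBinomial-above d (s≤s N<m))) (zeroˡ (poch d d (suc m))))
                         (≈-sym (qFalling-above d (s≤s N<m)))
... | inj₂ m≤N = begin
  (qBinomial d N (suc m) +ₚ x *ₚ qBinomial d N m) *ₚ poch d d (suc m)
    ≈⟨ *-congˡ {qBinomial d N (suc m) +ₚ x *ₚ qBinomial d N m} (poch-suc-top d d m) ⟩
  (qBinomial d N (suc m) +ₚ x *ₚ qBinomial d N m) *ₚ (poch d d m *ₚ 1-q^ (d ℕ.+ d ℕ.* m))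
    ≈⟨ expand (qBinomial d N (suc m)) x (qBinomial d N m) (poch d d m) (X^ (d ℕ.+ d ℕ.* m)) ⟩
  qBinomial d N (suc m) *ₚ (poch d d m *ₚ 1-q^ (d ℕ.+ d ℕ.* m)) +ₚ x *ₚ (qBinomial d N m *ₚ poch d d m) *ₚ 1-q^ (d ℕ.+ d ℕ.* m)
    ≈⟨ +-cong (≈-trans (*-congˡ {qBinomial d N (suc m)} (≈-sym (poch-suc-top d d m))) (qBinomial-poch d N (suc m)))
              (*-congʳ {1-q^ (d ℕ.+ d ℕ.* m)} (*-congˡ {x} (qBinomial-poch d N m))) ⟩
  qFalling d N (suc m) +ₚ x *ₚ qFalling d N m *ₚ 1-q^ (d ℕ.+ d ℕ.* m)
    ≈⟨ +-congʳ {x *ₚ qFalling d N m *ₚ 1-q^ (d ℕ.+ d ℕ.* m)} (∏-suc m (λ j → 1-q^ (d ℕ.* (N ∸ j)))) ⟩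
  qFalling d N m *ₚ 1-q^ (d ℕ.* (N ∸ m)) +ₚ x *ₚ qFalling d N m *ₚ 1-q^ (d ℕ.+ d ℕ.* m)
    ≈⟨ collect (qFalling d N m) x (X^ (d ℕ.+ d ℕ.* m)) ⟩
  (1ₚ -ₚ x *ₚ X^ (d ℕ.+ d ℕ.* m)) *ₚ qFalling d N m
    ≈⟨ *-congʳ {qFalling d N m} (+-congˡ {1ₚ} (-‿cong (≈-trans (X^-+ (d ℕ.* (N ∸ m)) (d ℕ.+ d ℕ.* m)) (X^-cong exponent)))) ⟩
  1-q^ (d ℕ.* suc N) *ₚ qFalling d N m
    ∎
  where
  open ≈-Reasoning
  open Solver
  x = X^ (d ℕ.* (N ∸ m))
  expand : ∀ a x b P y → (a +ₚ x *ₚ b) *ₚ (P *ₚ (1ₚ -ₚ y)) ≐ a *ₚ (P *ₚ (1ₚ -ₚ y)) +ₚ x *ₚ (b *ₚ P) *ₚ (1ₚ -ₚ y)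
  expand = solve 5 (λ a x b P y → (a :+ x :* b) :* (P :* (:1 :- y)) := a :* (P :* (:1 :- y)) :+ x :* (b :* P) :* (:1 :- y)) ≈-refl
  collect : ∀ F x y → F *ₚ (1ₚ -ₚ x) +ₚ x *ₚ F *ₚ (1ₚ -ₚ y) ≐ (1ₚ -ₚ x *ₚ y) *ₚ F
  collect = solve 3 (λ F x y → F :* (:1 :- x) :+ x :* F :* (:1 :- y) := (:1 :- x :* y) :* F) ≈-refl
  exponent : d ℕ.* (N ∸ m) ℕ.+ (d ℕ.+ d ℕ.* m) ≡ d ℕ.* suc N
  exponent = trans (arith d (N ∸ m) m) (cong (λ n → d ℕ.* suc n) (ℕP.m∸n+n≡m m≤N))
    where
    arith : ∀ d r m → d ℕ.* r ℕ.+ (d ℕ.+ d ℕ.* m) ≡ d ℕ.* suc (r ℕ.+ m)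
    arith = ℕ-Solver.solve-∀

-- σ c d m = (-1)^m q^(cm + d·m(m-1)/2)
σ : ℕ → ℕ → ℕ → PS
σ c d m = ∏ m (λ j → negₚ (X^ (c ℕ.+ d ℕ.* j)))

module _ (c d : ℕ) where

  vandermondeTerm : ℕ → ℕ → ℕ → PS
  vandermondeTerm N b m =
    σ c d m *ₚ qBinomial d N m *ₚ (poch b d m *ₚ poch (b ℕ.+ c ℕ.+ d ℕ.* m) d (N ∸ m))

  binomial-above-vanishes : ∀ N P → σ c d (suc N) *ₚ qBinomial d N (suc N) *ₚ P ≐ 0ₚ
  binomial-above-vanishes N P = ≈-trans
    (*-congʳ {P} (≈-trans (*-congˡ {σ c d (suc N)} (qBinomial-above d (ℕP.n<1+n N))) (zeroʳ (σ c d (suc N)))))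
    (zeroˡ P)

  vandermondeTerm-lengthen : ∀ N b m → m ≤ suc N →
    σ c d m *ₚ qBinomial d N m *ₚ (poch b d m *ₚ poch (b ℕ.+ c ℕ.+ d ℕ.* m) d (suc N ∸ m))
      ≐ 1-q^ (b ℕ.+ c ℕ.+ d ℕ.* N) *ₚ vandermondeTerm N b m
  vandermondeTerm-lengthen N b m m≤1+N with ℕP.m≤n⇒m<n∨m≡n m≤1+N
  ... | inj₂ refl = ≈-trans (binomial-above-vanishes N _)
                            (≈-sym (≈-trans (*-congˡ {1-q^ (b ℕ.+ c ℕ.+ d ℕ.* N)} (binomial-above-vanishes N _))
                                            (zeroʳ (1-q^ (b ℕ.+ c ℕ.+ d ℕ.* N)))))
  ... | inj₁ (s≤s m≤N) = begin
    A *ₚ (poch b d m *ₚ poch e d (suc N ∸ m))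
      ≡⟨ cong (λ n → A *ₚ (poch b d m *ₚ poch e d n)) (ℕP.+-∸-assoc 1 m≤N) ⟩
    A *ₚ (poch b d m *ₚ poch e d (suc (N ∸ m)))
      ≈⟨ *-congˡ {A} (*-congˡ {poch b d m} (poch-suc-top e d (N ∸ m))) ⟩
    A *ₚ (poch b d m *ₚ (poch e d (N ∸ m) *ₚ 1-q^ (e ℕ.+ d ℕ.* (N ∸ m))))
      ≈⟨ regroup A (poch b d m) (poch e d (N ∸ m)) (1-q^ (e ℕ.+ d ℕ.* (N ∸ m))) ⟩
    1-q^ (e ℕ.+ d ℕ.* (N ∸ m)) *ₚ (A *ₚ (poch b d m *ₚ poch e d (N ∸ m)))
      ≈⟨ *-congʳ {A *ₚ (poch b d m *ₚ poch e d (N ∸ m))} (1-q^-cong exponent) ⟩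
    1-q^ (b ℕ.+ c ℕ.+ d ℕ.* N) *ₚ vandermondeTerm N b m
      ∎
    where
    open ≈-Reasoning
    open Solver
    A = σ c d m *ₚ qBinomial d N m
    e = b ℕ.+ c ℕ.+ d ℕ.* m
    regroup : ∀ A P Q y → A *ₚ (P *ₚ (Q *ₚ y)) ≐ y *ₚ (A *ₚ (P *ₚ Q))
    regroup = solve 4 (λ A P Q y → A :* (P :* (Q :* y)) := y :* (A :* (P :* Q))) ≈-refl
    arith : ∀ e d m r → e ℕ.+ d ℕ.* m ℕ.+ d ℕ.* r ≡ e ℕ.+ d ℕ.* (m ℕ.+ r)
    arith = ℕ-Solver.solve-∀
    exponent : e ℕ.+ d ℕ.* (N ∸ m) ≡ b ℕ.+ c ℕ.+ d ℕ.* N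
    exponent = trans (arith (b ℕ.+ c) d m (N ∸ m)) (cong (λ n → b ℕ.+ c ℕ.+ d ℕ.* n) (ℕP.m+[n∸m]≡n m≤N))

  vandermondeTerm-shift : ∀ N b m → m ≤ N →
    σ c d (suc m) *ₚ (X^ (d ℕ.* (N ∸ m)) *ₚ qBinomial d N m)
      *ₚ (poch b d (suc m) *ₚ poch (b ℕ.+ c ℕ.+ d ℕ.* suc m) d (N ∸ m))
      ≐ (negₚ (X^ (c ℕ.+ d ℕ.* N)) *ₚ 1-q^ b) *ₚ vandermondeTerm N (b ℕ.+ d) m
  vandermondeTerm-shift N b m m≤N = begin
    σ c d (suc m) *ₚ (x *ₚ q) *ₚ (poch b d (suc m) *ₚ poch (b ℕ.+ c ℕ.+ d ℕ.* suc m) d (N ∸ m))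
      ≈⟨ *-cong (*-congʳ {x *ₚ q} (∏-suc m (λ j → negₚ (X^ (c ℕ.+ d ℕ.* j)))))
                (*-cong (poch-suc b d m) (≈-reflexive (cong (λ e → poch e d (N ∸ m)) (arith₁ b c d m)))) ⟩
    σ c d m *ₚ negₚ y *ₚ (x *ₚ q) *ₚ (1-q^ b *ₚ P₁ *ₚ P₂)
      ≈⟨ regroup (σ c d m) y x q (1-q^ b) P₁ P₂ ⟩
    (negₚ (y *ₚ x) *ₚ 1-q^ b) *ₚ vandermondeTerm N (b ℕ.+ d) m
      ≈⟨ *-congʳ {vandermondeTerm N (b ℕ.+ d) m}
           (*-congʳ {1-q^ b} (-‿cong (≈-trans (X^-+ (c ℕ.+ d ℕ.* m) (d ℕ.* (N ∸ m))) (X^-cong exponent)))) ⟩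
    (negₚ (X^ (c ℕ.+ d ℕ.* N)) *ₚ 1-q^ b) *ₚ vandermondeTerm N (b ℕ.+ d) m
      ∎
    where
    open ≈-Reasoning
    open Solver
    x = X^ (d ℕ.* (N ∸ m))
    y = X^ (c ℕ.+ d ℕ.* m)
    q = qBinomial d N m
    P₁ = poch (b ℕ.+ d) d m
    P₂ = poch (b ℕ.+ d ℕ.+ c ℕ.+ d ℕ.* m) d (N ∸ m)
    regroup : ∀ s y x q o P₁ P₂ →
      s *ₚ negₚ y *ₚ (x *ₚ q) *ₚ (o *ₚ P₁ *ₚ P₂) ≐ (negₚ (y *ₚ x) *ₚ o) *ₚ (s *ₚ q *ₚ (P₁ *ₚ P₂))
    regroup = solve 7 (λ s y x q o P₁ P₂ →
      s :* (:- y) :* (x :* q) :* (o :* P₁ :* P₂) := (:- (y :* x) :* o) :* (s :* q :* (P₁ :* P₂))) ≈-refl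
    arith₁ : ∀ b c d m → b ℕ.+ c ℕ.+ d ℕ.* suc m ≡ b ℕ.+ d ℕ.+ c ℕ.+ d ℕ.* m
    arith₁ = ℕ-Solver.solve-∀
    arith₂ : ∀ c d m r → c ℕ.+ d ℕ.* m ℕ.+ d ℕ.* r ≡ c ℕ.+ d ℕ.* (m ℕ.+ r)
    arith₂ = ℕ-Solver.solve-∀
    exponent : c ℕ.+ d ℕ.* m ℕ.+ d ℕ.* (N ∸ m) ≡ c ℕ.+ d ℕ.* N
    exponent = trans (arith₂ c d m (N ∸ m)) (cong (λ n → c ℕ.+ d ℕ.* n) (ℕP.m+[n∸m]≡n m≤N))

  vandermonde-recurrence : ∀ N b →
    ∑ (suc (suc N)) (vandermondeTerm (suc N) b)
      ≐ 1-q^ (b ℕ.+ c ℕ.+ d ℕ.* N) *ₚ ∑ (suc N) (vandermondeTerm N b)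
        +ₚ (negₚ (X^ (c ℕ.+ d ℕ.* N)) *ₚ 1-q^ b) *ₚ ∑ (suc N) (vandermondeTerm N (b ℕ.+ d))
  vandermonde-recurrence N b = begin
    lengthened 0 +ₚ ∑ (suc N) (λ m → vandermondeTerm (suc N) b (suc m))
      ≈⟨ +-congˡ {lengthened 0} (∑-cong (suc N) (λ m _ → pascal m)) ⟩
    lengthened 0 +ₚ ∑ (suc N) (λ m → lengthened (suc m) +ₚ shifted m)
      ≈⟨ +-congˡ {lengthened 0} (∑-+ (suc N) (lengthened ∘ suc) shifted) ⟩
    lengthened 0 +ₚ (∑ (suc N) (lengthened ∘ suc) +ₚ ∑ (suc N) shifted)
      ≈⟨ +-assoc (lengthened 0) _ _ ⟨
    ∑ (suc (suc N)) lengthened +ₚ ∑ (suc N) shifted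
      ≈⟨ +-cong (∑-cong (suc (suc N)) (λ m m<2+N → vandermondeTerm-lengthen N b m (ℕP.≤-pred m<2+N)))
                (∑-cong (suc N) (λ m m<1+N → vandermondeTerm-shift N b m (ℕP.≤-pred m<1+N))) ⟩
    ∑ (suc (suc N)) (λ m → y *ₚ vandermondeTerm N b m) +ₚ ∑ (suc N) (λ m → K *ₚ vandermondeTerm N (b ℕ.+ d) m)
      ≈⟨ +-cong (≈-sym (*-distribˡ-∑ y (suc (suc N)) (vandermondeTerm N b)))
                (≈-sym (*-distribˡ-∑ K (suc N) (vandermondeTerm N (b ℕ.+ d)))) ⟩
    y *ₚ ∑ (suc (suc N)) (vandermondeTerm N b) +ₚ K *ₚ ∑ (suc N) (vandermondeTerm N (b ℕ.+ d))
      ≈⟨ +-congʳ {K *ₚ ∑ (suc N) (vandermondeTerm N (b ℕ.+ d))} (*-congˡ {y} drop-top) ⟩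
    y *ₚ ∑ (suc N) (vandermondeTerm N b) +ₚ K *ₚ ∑ (suc N) (vandermondeTerm N (b ℕ.+ d))
      ∎
    where
    open ≈-Reasoning
    open Solver
    y = 1-q^ (b ℕ.+ c ℕ.+ d ℕ.* N)
    K = negₚ (X^ (c ℕ.+ d ℕ.* N)) *ₚ 1-q^ b
    lengthened : ℕ → PS
    lengthened m = σ c d m *ₚ qBinomial d N m *ₚ (poch b d m *ₚ poch (b ℕ.+ c ℕ.+ d ℕ.* m) d (suc N ∸ m))
    shifted : ℕ → PS
    shifted m = σ c d (suc m) *ₚ (X^ (d ℕ.* (N ∸ m)) *ₚ qBinomial d N m)
                  *ₚ (poch b d (suc m) *ₚ poch (b ℕ.+ c ℕ.+ d ℕ.* suc m) d (N ∸ m))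
    split : ∀ s a x q F → s *ₚ (a +ₚ x *ₚ q) *ₚ F ≐ s *ₚ a *ₚ F +ₚ s *ₚ (x *ₚ q) *ₚ F
    split = solve 5 (λ s a x q F → s :* (a :+ x :* q) :* F := s :* a :* F :+ s :* (x :* q) :* F) ≈-refl
    pascal : ∀ m → vandermondeTerm (suc N) b (suc m) ≐ lengthened (suc m) +ₚ shifted m
    pascal m = split (σ c d (suc m)) (qBinomial d N (suc m)) (X^ (d ℕ.* (N ∸ m))) (qBinomial d N m)
                     (poch b d (suc m) *ₚ poch (b ℕ.+ c ℕ.+ d ℕ.* suc m) d (N ∸ m))
    drop-top : ∑ (suc (suc N)) (vandermondeTerm N b) ≐ ∑ (suc N) (vandermondeTerm N b)
    drop-top = ≈-trans (∑-suc (suc N) (vandermondeTerm N b))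
                       (≈-trans (+-congˡ {∑ (suc N) (vandermondeTerm N b)} (binomial-above-vanishes N _))
                                (+-identityʳ _))

  -- The terminating q-Chu–Vandermonde sum ₂φ₁(p^-N, a; ax; p, x p^N) = (x; p)_N / (ax; p)_N
  -- for p = q^d, a = q^b, x = q^c, multiplied by (ax; p)_N.  The telescoping argument
  -- rests on the right-hand side not depending on b.
  qChuVandermonde : ∀ N b → ∑ (suc N) (vandermondeTerm N b) ≐ poch c d N
  qChuVandermonde zero    b = ≈-trans (+-identityʳ (vandermondeTerm 0 b 0))
                                      (≈-trans (*-cong (*-identityˡ 1ₚ) (*-identityˡ 1ₚ)) (*-identityˡ 1ₚ))
  qChuVandermonde (suc N) b = begin
    ∑ (suc (suc N)) (vandermondeTerm (suc N) b)
      ≈⟨ vandermonde-recurrence N b ⟩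
    1-q^ (b ℕ.+ c ℕ.+ d ℕ.* N) *ₚ ∑ (suc N) (vandermondeTerm N b) +ₚ K *ₚ ∑ (suc N) (vandermondeTerm N (b ℕ.+ d))
      ≈⟨ +-cong (*-congˡ {1-q^ (b ℕ.+ c ℕ.+ d ℕ.* N)} (qChuVandermonde N b))
                (*-congˡ {K} (qChuVandermonde N (b ℕ.+ d))) ⟩
    1-q^ (b ℕ.+ c ℕ.+ d ℕ.* N) *ₚ poch c d N +ₚ K *ₚ poch c d N
      ≈⟨ +-congʳ {K *ₚ poch c d N} (*-congʳ {poch c d N}
           (+-congˡ {1ₚ} (-‿cong (≈-sym (≈-trans (X^-+ (c ℕ.+ d ℕ.* N) b) (X^-cong (arith b c d N))))))) ⟩
    (1ₚ -ₚ X^ (c ℕ.+ d ℕ.* N) *ₚ X^ b) *ₚ poch c d N +ₚ K *ₚ poch c d N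
      ≈⟨ collect (X^ (c ℕ.+ d ℕ.* N)) (X^ b) (poch c d N) ⟩
    poch c d N *ₚ 1-q^ (c ℕ.+ d ℕ.* N)
      ≈⟨ poch-suc-top c d N ⟨
    poch c d (suc N)
      ∎
    where
    open ≈-Reasoning
    open Solver
    K = negₚ (X^ (c ℕ.+ d ℕ.* N)) *ₚ 1-q^ b
    arith : ∀ b c d N → c ℕ.+ d ℕ.* N ℕ.+ b ≡ b ℕ.+ c ℕ.+ d ℕ.* N
    arith = ℕ-Solver.solve-∀
    collect : ∀ u v P → (1ₚ -ₚ u *ₚ v) *ₚ P +ₚ (negₚ u *ₚ (1ₚ -ₚ v)) *ₚ P ≐ P *ₚ (1ₚ -ₚ u)
    collect = solve 3 (λ u v P → (:1 :- u :* v) :* P :+ (:- u :* (:1 :- v)) :* P := P :* (:1 :- u)) ≈-refl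

-- The Laurent polynomial (q^(4-2k); q²)_n q^((2k-1)n)

coefₜ : ℤ → ℤ × ℤ → ℤ
coefₜ e (e′ , a) = if ⌊ e′ ℤ.≟ e ⌋ then a else + 0

-- coefₗ p (+ m) is toPS p m by definition.
coefₗ : LPoly → ℤ → ℤ
coefₗ p e = sumℤ (map (coefₜ e) p)

coefₜ-⇔ : ∀ {e₁ e₂ e₁′ e₂′} a → e₁ ≡ e₂ ⇔ e₁′ ≡ e₂′ → coefₜ e₂ (e₁ , a) ≡ coefₜ e₂′ (e₁′ , a)
coefₜ-⇔ {e₁} {e₂} {e₁′} {e₂′} a iff = cong (λ β → if β then a else + 0) (begin
  ⌊ e₁ ℤ.≟ e₂ ⌋       ≡⟨ isYes≗does (e₁ ℤ.≟ e₂) ⟩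
  does (e₁ ℤ.≟ e₂)    ≡⟨ does-⇔ iff (e₁ ℤ.≟ e₂) (e₁′ ℤ.≟ e₂′) ⟩
  does (e₁′ ℤ.≟ e₂′)  ≡⟨ isYes≗does (e₁′ ℤ.≟ e₂′) ⟨
  ⌊ e₁′ ℤ.≟ e₂′ ⌋     ∎)
  where open ≡-Reasoning

coefₜ-* : ∀ e e′ a c → coefₜ e (e′ , a ℤ.* c) ≡ a ℤ.* coefₜ e (e′ , c)
coefₜ-* e e′ a c with ⌊ e′ ℤ.≟ e ⌋
... | true  = refl
... | false = sym (ℤP.*-zeroʳ a)

+≡⇔≡- : ∀ x y z → x ℤ.+ y ≡ z ⇔ y ≡ z ℤ.- x
+≡⇔≡- x y z = mk⇔ (λ x+y≡z → trans (cancelʳ x y) (cong (ℤ._- x) x+y≡z))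
                  (λ y≡z-x → trans (cong (ℤ._+_ x) y≡z-x) (cancelˡ x z))
  where
  cancelʳ : ∀ x y → y ≡ x ℤ.+ y ℤ.- x
  cancelʳ = ℤ-Solver.solve-∀
  cancelˡ : ∀ x z → x ℤ.+ (z ℤ.- x) ≡ z
  cancelˡ = ℤ-Solver.solve-∀

≡-‿swap : ∀ x y z → y ≡ z ℤ.- x → x ≡ z ℤ.- y
≡-‿swap x y z y≡z-x = trans (double-negation x z) (cong (ℤ._-_ z) (sym y≡z-x))
  where
  double-negation : ∀ x z → x ≡ z ℤ.- (z ℤ.- x)
  double-negation = ℤ-Solver.solve-∀

coefₗ-++ : ∀ p r e → coefₗ (p ++ r) e ≡ coefₗ p e ℤ.+ coefₗ r e
coefₗ-++ []      r e = sym (ℤP.+-identityˡ (coefₗ r e))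
coefₗ-++ (t ∷ p) r e = trans (cong (ℤ._+_ (coefₜ e t)) (coefₗ-++ p r e)) (sym (ℤP.+-assoc (coefₜ e t) _ _))

coefₗ-monomial-*ₗ : ∀ s a r e → coefₗ (((s , a) ∷ []) *ₗ r) e ≡ a ℤ.* coefₗ r (e ℤ.- s)
coefₗ-monomial-*ₗ s a []              e = sym (ℤP.*-zeroʳ a)
coefₗ-monomial-*ₗ s a ((e′ , c) ∷ r) e = begin
  coefₜ e (s ℤ.+ e′ , a ℤ.* c) ℤ.+ coefₗ (((s , a) ∷ []) *ₗ r) e
    ≡⟨ cong₂ ℤ._+_ (trans (coefₜ-⇔ (a ℤ.* c) (+≡⇔≡- s e′ e)) (coefₜ-* (e ℤ.- s) e′ a c))
                   (coefₗ-monomial-*ₗ s a r e) ⟩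
  a ℤ.* coefₜ (e ℤ.- s) (e′ , c) ℤ.+ a ℤ.* coefₗ r (e ℤ.- s)
    ≡⟨ ℤP.*-distribˡ-+ a _ _ ⟨
  a ℤ.* coefₗ ((e′ , c) ∷ r) (e ℤ.- s)
    ∎
  where open ≡-Reasoning

coefₗ-∷-*ₗ : ∀ s a p r e → coefₗ (((s , a) ∷ p) *ₗ r) e ≡ a ℤ.* coefₗ r (e ℤ.- s) ℤ.+ coefₗ (p *ₗ r) e
coefₗ-∷-*ₗ s a p r e = begin
  coefₗ (((s , a) ∷ p) *ₗ r) e                                 ≡⟨ coefₗ-++ (map _ r) (p *ₗ r) e ⟩
  coefₗ (map _ r) e ℤ.+ coefₗ (p *ₗ r) e                       ≡⟨ cong (ℤ._+ coefₗ (p *ₗ r) e) single ⟩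
  a ℤ.* coefₗ r (e ℤ.- s) ℤ.+ coefₗ (p *ₗ r) e                 ∎
  where
  open ≡-Reasoning
  single : coefₗ (map _ r) e ≡ a ℤ.* coefₗ r (e ℤ.- s)
  single = trans (sym (trans (coefₗ-++ (map _ r) [] e) (ℤP.+-identityʳ _))) (coefₗ-monomial-*ₗ s a r e)

coefₗ-*ₗ-Xₗ : ∀ p s e → coefₗ (p *ₗ Xₗ s) e ≡ coefₗ p (e ℤ.- s)
coefₗ-*ₗ-Xₗ []             s e = refl
coefₗ-*ₗ-Xₗ ((e₁ , a) ∷ p) s e = begin
  coefₗ (((e₁ , a) ∷ p) *ₗ Xₗ s) e
    ≡⟨ coefₗ-∷-*ₗ e₁ a p (Xₗ s) e ⟩
  a ℤ.* (coefₜ (e ℤ.- e₁) (s , + 1) ℤ.+ + 0) ℤ.+ coefₗ (p *ₗ Xₗ s) e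
    ≡⟨ cong₂ ℤ._+_ monomial (coefₗ-*ₗ-Xₗ p s e) ⟩
  coefₜ (e ℤ.- s) (e₁ , a) ℤ.+ coefₗ p (e ℤ.- s)
    ∎
  where
  open ≡-Reasoning
  swap : s ≡ e ℤ.- e₁ ⇔ e₁ ≡ e ℤ.- s
  swap = mk⇔ (≡-‿swap e₁ s e) (≡-‿swap s e₁ e)
  monomial : a ℤ.* (coefₜ (e ℤ.- e₁) (s , + 1) ℤ.+ + 0) ≡ coefₜ (e ℤ.- s) (e₁ , a)
  monomial = begin
    a ℤ.* (coefₜ (e ℤ.- e₁) (s , + 1) ℤ.+ + 0)   ≡⟨ cong (a ℤ.*_) (ℤP.+-identityʳ _) ⟩
    a ℤ.* coefₜ (e ℤ.- e₁) (s , + 1)             ≡⟨ coefₜ-* (e ℤ.- e₁) s a (+ 1) ⟨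
    coefₜ (e ℤ.- e₁) (s , a ℤ.* + 1)             ≡⟨ cong (λ a′ → coefₜ (e ℤ.- e₁) (s , a′)) (ℤP.*-identityʳ a) ⟩
    coefₜ (e ℤ.- e₁) (s , a)                     ≡⟨ coefₜ-⇔ a swap ⟩
    coefₜ (e ℤ.- s) (e₁ , a)                     ∎

factorₗ : ℤ → LPoly
factorₗ h = (+ 0 , + 1) ∷ (h , - + 1) ∷ []

coefₗ-factorₗ-*ₗ : ∀ h r e → coefₗ (factorₗ h *ₗ r) e ≡ coefₗ r e ℤ.- coefₗ r (e ℤ.- h)
coefₗ-factorₗ-*ₗ h r e = begin
  coefₗ (factorₗ h *ₗ r) e
    ≡⟨ coefₗ-∷-*ₗ (+ 0) (+ 1) ((h , - + 1) ∷ []) r e ⟩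
  + 1 ℤ.* coefₗ r (e ℤ.- + 0) ℤ.+ coefₗ (((h , - + 1) ∷ []) *ₗ r) e
    ≡⟨ cong₂ ℤ._+_ (trans (ℤP.*-identityˡ _) (cong (coefₗ r) (ℤP.+-identityʳ e))) (coefₗ-monomial-*ₗ h (- + 1) r e) ⟩
  coefₗ r e ℤ.+ - + 1 ℤ.* coefₗ r (e ℤ.- h)
    ≡⟨ cong (ℤ._+_ (coefₗ r e)) (ℤP.-1*i≡-i _) ⟩
  coefₗ r e ℤ.- coefₗ r (e ℤ.- h)
    ∎
  where open ≡-Reasoning

extℤ : PS → ℤ → ℤ
extℤ f (+ m)     = f m
extℤ f -[1+ _ ]  = + 0

extℤ-cong : ∀ {f g} → f ≐ g → ∀ z → extℤ f z ≡ extℤ g z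
extℤ-cong f≐g (+ m)     = f≐g m
extℤ-cong f≐g -[1+ _ ]  = refl

extℤ-difference : ∀ f g z → extℤ (f -ₚ g) z ≡ extℤ f z ℤ.- extℤ g z
extℤ-difference f g (+ m)     = refl
extℤ-difference f g -[1+ _ ]  = refl

extℤ-shift : ∀ a f z → extℤ (shift a f) z ≡ extℤ f (z ℤ.- + a)
extℤ-shift zero    f z          = cong (extℤ f) (sym (ℤP.+-identityʳ z))
extℤ-shift (suc a) f (+ zero)   = refl
extℤ-shift (suc a) f (+ suc m)  =
  trans (extℤ-shift a f (+ m)) (cong (extℤ f) (trans (ℤP.m-n≡m⊖n m a) (sym (ℤP.[1+m]⊖[1+n]≡m⊖n m a))))
extℤ-shift (suc a) f -[1+ _ ]   = refl

extℤ-X^-* : ∀ a f z → extℤ (X^ a *ₚ f) z ≡ extℤ f (z ℤ.- + a)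
extℤ-X^-* a f z = trans (extℤ-cong (X^-*ₚ-shift a f) z) (extℤ-shift a f z)

∏ₗ : ℕ → (ℕ → ℤ) → LPoly
∏ₗ n h = foldr _*ₗ_ 1ₗ (applyUpTo (factorₗ ∘ h) n)

coefₗ-∏ₗ : ∀ c n h (b : ℕ → ℕ) → (∀ j → + c ℤ.+ h j ≡ + b j) → ∀ e →
  coefₗ (∏ₗ n h) e ≡ extℤ (∏ n (λ j → X^ c -ₚ X^ (b j))) (e ℤ.+ + (c ℕ.* n))
coefₗ-∏ₗ c zero h b c+h≡b e = trans (coefₗ-1ₗ e) (cong (λ k → extℤ 1ₚ (e ℤ.+ + k)) (sym (ℕP.*-zeroʳ c)))
  where
  coefₗ-1ₗ : ∀ e → coefₗ 1ₗ e ≡ extℤ 1ₚ (e ℤ.+ + 0)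
  coefₗ-1ₗ (+ zero)   = refl
  coefₗ-1ₗ (+ suc m)  = refl
  coefₗ-1ₗ -[1+ _ ]   = refl
coefₗ-∏ₗ c (suc n) h b c+h≡b e = begin
  coefₗ (factorₗ (h 0) *ₗ ∏ₗ n (h ∘ suc)) e
    ≡⟨ coefₗ-factorₗ-*ₗ (h 0) (∏ₗ n (h ∘ suc)) e ⟩
  coefₗ (∏ₗ n (h ∘ suc)) e ℤ.- coefₗ (∏ₗ n (h ∘ suc)) (e ℤ.- h 0)
    ≡⟨ cong₂ ℤ._-_ (IH e) (IH (e ℤ.- h 0)) ⟩
  extℤ Φ (e ℤ.+ + (c ℕ.* n)) ℤ.- extℤ Φ (e ℤ.- h 0 ℤ.+ + (c ℕ.* n))
    ≡⟨ cong₂ (λ u v → extℤ Φ u ℤ.- extℤ Φ v) (shift₁ e (+ c) (+ (c ℕ.* n)))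
                                             (trans (shift₂ e (+ c) (h 0) (+ (c ℕ.* n))) (cong (ℤ._-_ z) (c+h≡b 0))) ⟩
  extℤ Φ (z ℤ.- + c) ℤ.- extℤ Φ (z ℤ.- + b 0)
    ≡⟨ cong₂ ℤ._-_ (extℤ-X^-* c Φ z) (extℤ-X^-* (b 0) Φ z) ⟨
  extℤ (X^ c *ₚ Φ) z ℤ.- extℤ (X^ (b 0) *ₚ Φ) z
    ≡⟨ extℤ-difference (X^ c *ₚ Φ) (X^ (b 0) *ₚ Φ) z ⟨
  extℤ (X^ c *ₚ Φ -ₚ X^ (b 0) *ₚ Φ) z
    ≡⟨ extℤ-cong (factor-out (X^ c) (X^ (b 0)) Φ) z ⟩
  extℤ (∏ (suc n) (λ j → X^ c -ₚ X^ (b j))) z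
    ≡⟨ cong (λ k → extℤ (∏ (suc n) (λ j → X^ c -ₚ X^ (b j))) (e ℤ.+ + k)) (ℕP.*-suc c n) ⟨
  extℤ (∏ (suc n) (λ j → X^ c -ₚ X^ (b j))) (e ℤ.+ + (c ℕ.* suc n))
    ∎
  where
  open ≡-Reasoning
  open Solver using (solve; _:=_; _:*_; _:-_)
  Φ = ∏ n (λ j → X^ c -ₚ X^ (b (suc j)))
  z = e ℤ.+ + (c ℕ.+ c ℕ.* n)
  IH = coefₗ-∏ₗ c n (h ∘ suc) (b ∘ suc) (c+h≡b ∘ suc)
  shift₁ : ∀ e c x → e ℤ.+ x ≡ e ℤ.+ (c ℤ.+ x) ℤ.- c
  shift₁ = ℤ-Solver.solve-∀
  shift₂ : ∀ e c h x → e ℤ.- h ℤ.+ x ≡ e ℤ.+ (c ℤ.+ x) ℤ.- (c ℤ.+ h)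
  shift₂ = ℤ-Solver.solve-∀
  factor-out : ∀ x y Φ → x *ₚ Φ -ₚ y *ₚ Φ ≐ (x -ₚ y) *ₚ Φ
  factor-out = solve 3 (λ x y Φ → x :* Φ :- y :* Φ := (x :- y) :* Φ) ≈-refl

-- Multiplying each factor 1 - q^(a+dj) by q^c clears the negative exponents.
toPS-pochₗ-*ₗ-Xₗ : ∀ a d c n (b : ℕ → ℕ) → (∀ j → + c ℤ.+ (a ℤ.+ d ℤ.* + j) ≡ + b j) →
  toPS (pochₗ a d n *ₗ Xₗ (+ (c ℕ.* n))) ≐ ∏ n (λ j → X^ c -ₚ X^ (b j))
toPS-pochₗ-*ₗ-Xₗ a d c n b c+a+dj≡b m = begin
  coefₗ (pochₗ a d n *ₗ Xₗ s) (+ m)    ≡⟨ coefₗ-*ₗ-Xₗ (pochₗ a d n) s (+ m) ⟩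
  coefₗ (pochₗ a d n) (+ m ℤ.- s)      ≡⟨ cong (λ p → coefₗ p (+ m ℤ.- s)) (cong (foldr _*ₗ_ 1ₗ) (ListP.map-upTo _ n)) ⟩
  coefₗ (∏ₗ n h) (+ m ℤ.- s)           ≡⟨ coefₗ-∏ₗ c n h b c+a+dj≡b (+ m ℤ.- s) ⟩
  extℤ Φ (+ m ℤ.- s ℤ.+ s)             ≡⟨ cong (extℤ Φ) (cancel (+ m) s) ⟩
  Φ m                                  ∎
  where
  open ≡-Reasoning
  s = + (c ℕ.* n)
  h = λ j → a ℤ.+ d ℤ.* + j
  Φ = ∏ n (λ j → X^ c -ₚ X^ (b j))
  cancel : ∀ x y → x ℤ.- y ℤ.+ y ≡ x
  cancel = ℤ-Solver.solve-∀

numTerm-∏ : ∀ N m → numTerm (2 ℕ.+ N) m ≐ ∏ m (λ j → X^ (3 ℕ.+ 2 ℕ.* N) -ₚ X^ (3 ℕ.+ 2 ℕ.* j))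
numTerm-∏ N m = ≈-trans (toPS-pochₗ-*ₗ-Xₗ (+ 4 ℤ.- + (2 ℕ.* (2 ℕ.+ N))) (+ 2) (2 ℕ.* (2 ℕ.+ N) ∸ 1) m
                                          (λ j → 3 ℕ.+ 2 ℕ.* j) exponent)
                        (≈-reflexive (cong (λ c → ∏ m (λ j → X^ c -ₚ X^ (3 ℕ.+ 2 ℕ.* j))) c≡))
  where
  open ≡-Reasoning
  c≡ : 2 ℕ.* (2 ℕ.+ N) ∸ 1 ≡ 3 ℕ.+ 2 ℕ.* N
  c≡ = cong (_∸ 1) (double N)
    where
    double : ∀ N → 2 ℕ.* (2 ℕ.+ N) ≡ suc (3 ℕ.+ 2 ℕ.* N)
    double = ℕ-Solver.solve-∀
  +[a+2n] : ∀ a n → + (a ℕ.+ 2 ℕ.* n) ≡ + a ℤ.+ + 2 ℤ.* + n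
  +[a+2n] a n = trans (ℤP.pos-+ a (2 ℕ.* n)) (cong (ℤ._+_ (+ a)) (ℤP.pos-* 2 n))
  exponent : ∀ j → + (2 ℕ.* (2 ℕ.+ N) ∸ 1) ℤ.+ (+ 4 ℤ.- + (2 ℕ.* (2 ℕ.+ N)) ℤ.+ + 2 ℤ.* + j) ≡ + (3 ℕ.+ 2 ℕ.* j)
  exponent j = begin
    + (2 ℕ.* (2 ℕ.+ N) ∸ 1) ℤ.+ (+ 4 ℤ.- + (2 ℕ.* (2 ℕ.+ N)) ℤ.+ + 2 ℤ.* + j)
      ≡⟨ cong₂ (λ u v → u ℤ.+ (+ 4 ℤ.- v ℤ.+ + 2 ℤ.* + j)) (trans (cong +_ c≡) (+[a+2n] 3 N))
                                                          (trans (ℤP.pos-* 2 (2 ℕ.+ N)) (cong (ℤ._*_ (+ 2)) (ℤP.pos-+ 2 N))) ⟩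
    + 3 ℤ.+ + 2 ℤ.* + N ℤ.+ (+ 4 ℤ.- + 2 ℤ.* (+ 2 ℤ.+ + N) ℤ.+ + 2 ℤ.* + j)
      ≡⟨ simplify (+ N) (+ j) ⟩
    + 3 ℤ.+ + 2 ℤ.* + j
      ≡⟨ +[a+2n] 3 j ⟨
    + (3 ℕ.+ 2 ℕ.* j)
      ∎
    where
    simplify : ∀ n j → + 3 ℤ.+ + 2 ℤ.* n ℤ.+ (+ 4 ℤ.- + 2 ℤ.* (+ 2 ℤ.+ n) ℤ.+ + 2 ℤ.* j) ≡ + 3 ℤ.+ + 2 ℤ.* j
    simplify = ℤ-Solver.solve-∀

∏-X^-difference : ∀ c d N m → m ≤ N →
  ∏ m (λ j → X^ (c ℕ.+ d ℕ.* N) -ₚ X^ (c ℕ.+ d ℕ.* j)) ≐ σ c d m *ₚ qFalling d N m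
∏-X^-difference c d N m m≤N =
  ≈-trans (∏-cong m factor) (∏-* m (λ j → negₚ (X^ (c ℕ.+ d ℕ.* j))) (λ j → 1-q^ (d ℕ.* (N ∸ j))))
  where
  open Solver using (solve; _:=_; _:*_; _:-_; :-_)
  pull-out : ∀ x y → x *ₚ y -ₚ x ≐ negₚ x *ₚ (1ₚ -ₚ y)
  pull-out = solve 2 (λ x y → x :* y :- x := (:- x) :* (:1 :- y)) ≈-refl
  arith : ∀ c d j r → c ℕ.+ d ℕ.* j ℕ.+ d ℕ.* r ≡ c ℕ.+ d ℕ.* (j ℕ.+ r)
  arith = ℕ-Solver.solve-∀
  factor : ∀ j → j < m → X^ (c ℕ.+ d ℕ.* N) -ₚ X^ (c ℕ.+ d ℕ.* j) ≐ negₚ (X^ (c ℕ.+ d ℕ.* j)) *ₚ 1-q^ (d ℕ.* (N ∸ j))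
  factor j j<m = ≈-trans (+-congʳ {negₚ (X^ (c ℕ.+ d ℕ.* j))}
                                  (≈-sym (≈-trans (X^-+ (c ℕ.+ d ℕ.* j) (d ℕ.* (N ∸ j))) (X^-cong exponent))))
                         (pull-out (X^ (c ℕ.+ d ℕ.* j)) (X^ (d ℕ.* (N ∸ j))))
    where
    exponent : c ℕ.+ d ℕ.* j ℕ.+ d ℕ.* (N ∸ j) ≡ c ℕ.+ d ℕ.* N
    exponent = trans (arith c d j (N ∸ j)) (cong (λ n → c ℕ.+ d ℕ.* n) (ℕP.m+[n∸m]≡n (ℕP.<⇒≤ (ℕP.<-≤-trans j<m m≤N))))

numTerm-/-poch : ∀ N m → m ≤ N → numTerm (2 ℕ.+ N) m *ₚ inv (poch 2 2 m) ≐ σ 3 2 m *ₚ qBinomial 2 N m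
numTerm-/-poch N m m≤N = begin
  numTerm (2 ℕ.+ N) m *ₚ inv (poch 2 2 m)
    ≈⟨ *-congʳ {inv (poch 2 2 m)} (≈-trans (numTerm-∏ N m) (∏-X^-difference 3 2 N m m≤N)) ⟩
  σ 3 2 m *ₚ qFalling 2 N m *ₚ inv (poch 2 2 m)
    ≈⟨ *-congʳ {inv (poch 2 2 m)} (*-congˡ {σ 3 2 m} (qBinomial-poch 2 N m)) ⟨
  σ 3 2 m *ₚ (qBinomial 2 N m *ₚ poch 2 2 m) *ₚ inv (poch 2 2 m)
    ≈⟨ regroup (σ 3 2 m) (qBinomial 2 N m) (poch 2 2 m) (inv (poch 2 2 m)) ⟩
  σ 3 2 m *ₚ qBinomial 2 N m *ₚ (poch 2 2 m *ₚ inv (poch 2 2 m))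
    ≈⟨ *-congˡ {σ 3 2 m *ₚ qBinomial 2 N m} (*-inverseʳ (poch 2 2 m) (poch-≡1 2 2 m 0 (s≤s z≤n))) ⟩
  σ 3 2 m *ₚ qBinomial 2 N m *ₚ 1ₚ
    ≈⟨ *-identityʳ (σ 3 2 m *ₚ qBinomial 2 N m) ⟩
  σ 3 2 m *ₚ qBinomial 2 N m
    ∎
  where
  open ≈-Reasoning
  open Solver
  regroup : ∀ s q P P⁻¹ → s *ₚ (q *ₚ P) *ₚ P⁻¹ ≐ s *ₚ q *ₚ (P *ₚ P⁻¹)
  regroup = solve 4 (λ s q P P⁻¹ → s :* (q :* P) :* P⁻¹ := s :* q :* (P :* P⁻¹)) ≈-refl

-- Telescoping

ratio∞ : ℕ → ℕ → ℕ → PS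
ratio∞ d b a = poch∞ a d *ₚ poch∞ (a ℕ.+ b ℕ.+ 2) d *ₚ inv (poch∞ (a ℕ.+ 1) d *ₚ poch∞ (a ℕ.+ b ℕ.+ 1) d)

ratio∞-difference : ∀ d .{{_ : NonZero d}} b a →
  ratio∞ d b (a ℕ.+ d) -ₚ ratio∞ d b a
    ≐ X^ a *ₚ (1-q^ 1 *ₚ (1-q^ (b ℕ.+ 1) *ₚ (poch∞ (a ℕ.+ d) d *ₚ poch∞ (a ℕ.+ b ℕ.+ 2 ℕ.+ d) d
                                           *ₚ inv (poch∞ (a ℕ.+ 1) d *ₚ poch∞ (a ℕ.+ b ℕ.+ 1) d))))
ratio∞-difference d b a = begin
  ratio∞ d b (a ℕ.+ d) -ₚ ratio∞ d b a
    ≈⟨ +-cong shifted (-‿cong unshifted) ⟩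
  A′ *ₚ B′ *ₚ ((1-q^ (a ℕ.+ 1) *ₚ 1-q^ (a ℕ.+ b ℕ.+ 1)) *ₚ I)
    -ₚ 1-q^ a *ₚ A′ *ₚ (1-q^ (a ℕ.+ b ℕ.+ 2) *ₚ B′) *ₚ I
    ≈⟨ +-cong (*-congˡ {A′ *ₚ B′} (*-congʳ {I} (*-cong (1-q^-+ a 1) monomial₁)))
              (-‿cong (*-congʳ {I} (*-congˡ {1-q^ a *ₚ A′} (*-congʳ {B′} monomial₂)))) ⟩
  A′ *ₚ B′ *ₚ ((1ₚ -ₚ y *ₚ X^ 1) *ₚ (1ₚ -ₚ y *ₚ w) *ₚ I)
    -ₚ (1ₚ -ₚ y) *ₚ A′ *ₚ ((1ₚ -ₚ y *ₚ X^ 1 *ₚ w) *ₚ B′) *ₚ I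
    ≈⟨ telescoping-identity A′ B′ I y (X^ 1) w ⟩
  y *ₚ (1-q^ 1 *ₚ (1-q^ (b ℕ.+ 1) *ₚ (A′ *ₚ B′ *ₚ I)))
    ∎
  where
  open ≈-Reasoning
  open Solver
  y  = X^ a
  w  = X^ (b ℕ.+ 1)
  A′ = poch∞ (a ℕ.+ d) d
  B′ = poch∞ (a ℕ.+ b ℕ.+ 2 ℕ.+ d) d
  C′ = poch∞ (a ℕ.+ 1 ℕ.+ d) d
  D′ = poch∞ (a ℕ.+ b ℕ.+ 1 ℕ.+ d) d
  I  = inv (poch∞ (a ℕ.+ 1) d *ₚ poch∞ (a ℕ.+ b ℕ.+ 1) d)
  arith₁ : ∀ a b → a ℕ.+ b ℕ.+ 1 ≡ a ℕ.+ (b ℕ.+ 1)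
  arith₁ = ℕ-Solver.solve-∀
  arith₂ : ∀ a b → a ℕ.+ b ℕ.+ 2 ≡ a ℕ.+ 1 ℕ.+ (b ℕ.+ 1)
  arith₂ = ℕ-Solver.solve-∀
  arith₃ : ∀ a b d → a ℕ.+ d ℕ.+ b ℕ.+ 2 ≡ a ℕ.+ b ℕ.+ 2 ℕ.+ d
  arith₃ = ℕ-Solver.solve-∀
  arith₄ : ∀ a d → a ℕ.+ d ℕ.+ 1 ≡ a ℕ.+ 1 ℕ.+ d
  arith₄ = ℕ-Solver.solve-∀
  arith₅ : ∀ a b d → a ℕ.+ d ℕ.+ b ℕ.+ 1 ≡ a ℕ.+ b ℕ.+ 1 ℕ.+ d
  arith₅ = ℕ-Solver.solve-∀
  const : ∀ e → 0 < e → poch∞ e d 0 ≡ + 1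
  const e = poch∞-≡1 e d 0
  monomial₁ : 1-q^ (a ℕ.+ b ℕ.+ 1) ≐ 1ₚ -ₚ y *ₚ w
  monomial₁ = ≈-trans (1-q^-cong (arith₁ a b)) (1-q^-+ a (b ℕ.+ 1))
  monomial₂ : 1-q^ (a ℕ.+ b ℕ.+ 2) ≐ 1ₚ -ₚ y *ₚ X^ 1 *ₚ w
  monomial₂ = ≈-trans (1-q^-cong (arith₂ a b))
                      (≈-trans (1-q^-+ (a ℕ.+ 1) (b ℕ.+ 1)) (+-congˡ {1ₚ} (-‿cong (*-congʳ {w} (≈-sym (X^-+ a 1))))))
  peel : inv (C′ *ₚ D′) ≐ (1-q^ (a ℕ.+ 1) *ₚ 1-q^ (a ℕ.+ b ℕ.+ 1)) *ₚ I
  peel = inv-factor (1-q^ (a ℕ.+ 1) *ₚ 1-q^ (a ℕ.+ b ℕ.+ 1))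
           (*-const≡1 C′ D′ (const _ (ℕP.≤-trans (ℕP.m≤n+m 1 a) (ℕP.m≤m+n (a ℕ.+ 1) d)))
                            (const _ (ℕP.≤-trans (ℕP.m≤n+m 1 (a ℕ.+ b)) (ℕP.m≤m+n (a ℕ.+ b ℕ.+ 1) d))))
           (*-const≡1 (poch∞ (a ℕ.+ 1) d) (poch∞ (a ℕ.+ b ℕ.+ 1) d)
                      (const _ (ℕP.m≤n+m 1 a)) (const _ (ℕP.m≤n+m 1 (a ℕ.+ b))))
           (≈-trans (*-cong (poch∞-suc (a ℕ.+ 1) d) (poch∞-suc (a ℕ.+ b ℕ.+ 1) d))
                    (*-CS.interchange (1-q^ (a ℕ.+ 1)) C′ (1-q^ (a ℕ.+ b ℕ.+ 1)) D′))
  shifted : ratio∞ d b (a ℕ.+ d) ≐ A′ *ₚ B′ *ₚ ((1-q^ (a ℕ.+ 1) *ₚ 1-q^ (a ℕ.+ b ℕ.+ 1)) *ₚ I)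
  shifted = ≈-trans (*-cong (*-congˡ {A′} (poch∞-cong d (arith₃ a b d)))
                            (≈-reflexive (cong₂ (λ e₁ e₂ → inv (poch∞ e₁ d *ₚ poch∞ e₂ d)) (arith₄ a d) (arith₅ a b d))))
                    (*-congˡ {A′ *ₚ B′} peel)
  unshifted : ratio∞ d b a ≐ 1-q^ a *ₚ A′ *ₚ (1-q^ (a ℕ.+ b ℕ.+ 2) *ₚ B′) *ₚ I
  unshifted = *-congʳ {I} (*-cong (poch∞-suc a d) (poch∞-suc (a ℕ.+ b ℕ.+ 2) d))
  telescoping-identity : ∀ A B I y q w →
    A *ₚ B *ₚ ((1ₚ -ₚ y *ₚ q) *ₚ (1ₚ -ₚ y *ₚ w) *ₚ I) -ₚ (1ₚ -ₚ y) *ₚ A *ₚ ((1ₚ -ₚ y *ₚ q *ₚ w) *ₚ B) *ₚ I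
      ≐ y *ₚ ((1ₚ -ₚ q) *ₚ ((1ₚ -ₚ w) *ₚ (A *ₚ B *ₚ I)))
  telescoping-identity = solve 6 (λ A B I y q w →
    A :* B :* ((:1 :- y :* q) :* (:1 :- y :* w) :* I) :- (:1 :- y) :* A :* ((:1 :- y :* q :* w) :* B) :* I
      := y :* ((:1 :- q) :* ((:1 :- w) :* (A :* B :* I)))) ≈-refl

ratio∞-≡1 : ∀ d b a → ratio∞ d b a ≡ 1ₚ mod-q^ a
ratio∞-≡1 d b a = *ₚ-≡1 (*ₚ-≡1 (poch∞-≡1 a d) (far (ℕP.m≤m+n (a ℕ.+ b) 2)))
                        (inv-≡1 (*-const≡1 C D (poch∞-≡1 (a ℕ.+ 1) d 0 (ℕP.m≤n+m 1 a))
                                               (poch∞-≡1 (a ℕ.+ b ℕ.+ 1) d 0 (ℕP.m≤n+m 1 (a ℕ.+ b))))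
                                (*ₚ-≡1 (mod-q^-weaken (ℕP.m≤m+n a 1) (poch∞-≡1 (a ℕ.+ 1) d)) (far (ℕP.m≤m+n (a ℕ.+ b) 1))))
  where
  C = poch∞ (a ℕ.+ 1) d
  D = poch∞ (a ℕ.+ b ℕ.+ 1) d
  far : ∀ {e} → a ℕ.+ b ≤ e → poch∞ e d ≡ 1ₚ mod-q^ a
  far {e} a+b≤e = mod-q^-weaken (ℕP.≤-trans (ℕP.m≤m+n a b) a+b≤e) (poch∞-≡1 e d)

ratio∞-zero : ∀ d .{{_ : NonZero d}} b → ratio∞ d b 0 ≐ 0ₚ
ratio∞-zero d b = ≈-trans (*-congʳ {J} (≈-trans (*-congʳ {B} (poch∞-zero d)) (zeroˡ B))) (zeroˡ J)
  where
  B = poch∞ (b ℕ.+ 2) d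
  J = inv (poch∞ 1 d *ₚ poch∞ (b ℕ.+ 1) d)

module _ (N : ℕ) where

  prefactor : PS
  prefactor = X^ 1 *ₚ inv (1-q^ 1 *ₚ poch 1 2 (suc N))

  weight : ℕ → PS
  weight m = prefactor *ₚ (1-q^ 1 *ₚ (σ 3 2 m *ₚ qBinomial 2 N m *ₚ inv (1-q^ (2 ℕ.* m ℕ.+ 1))))

  RHS≐∑weight : RHS (2 ℕ.+ N) ≐ ∑ (suc N) weight
  RHS≐∑weight = begin
    prefactor *ₚ (1ₚ +ₚ 1-q^ 1 *ₚ sumₚ (map g (range 1 N)))
      ≈⟨ *-congˡ {prefactor} (+-congˡ {1ₚ} (*-congˡ {1-q^ 1} (≈-trans (≈-reflexive (cong sumₚ (map-range-1 g N)))
           (∑-cong N (λ m m<N → *-congʳ {inv (1-q^ (2 ℕ.* suc m ℕ.+ 1))} (numTerm-/-poch N (suc m) m<N)))))) ⟩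
    prefactor *ₚ (1ₚ +ₚ 1-q^ 1 *ₚ ∑ N (λ m → ε (suc m)))
      ≈⟨ distribˡ prefactor 1ₚ (1-q^ 1 *ₚ ∑ N (λ m → ε (suc m))) ⟩
    prefactor *ₚ 1ₚ +ₚ prefactor *ₚ (1-q^ 1 *ₚ ∑ N (λ m → ε (suc m)))
      ≈⟨ +-cong (≈-sym weight-zero)
                (≈-trans (*-congˡ {prefactor} (*-distribˡ-∑ (1-q^ 1) N (λ m → ε (suc m))))
                         (*-distribˡ-∑ prefactor N (λ m → 1-q^ 1 *ₚ ε (suc m)))) ⟩
    ∑ (suc N) weight
      ∎
    where
    open ≈-Reasoning
    g : ℕ → PS
    g n = numTerm (2 ℕ.+ N) n *ₚ inv (poch 2 2 n) *ₚ inv (1-q^ (2 ℕ.* n ℕ.+ 1))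
    ε : ℕ → PS
    ε m = σ 3 2 m *ₚ qBinomial 2 N m *ₚ inv (1-q^ (2 ℕ.* m ℕ.+ 1))
    weight-zero : weight 0 ≐ prefactor *ₚ 1ₚ
    weight-zero = *-congˡ {prefactor} (≈-trans (*-congˡ {1-q^ 1} (≈-trans (*-congʳ {inv (1-q^ 1)} (*-identityˡ 1ₚ))
                                                                          (*-identityˡ (inv (1-q^ 1)))))
                                               (*-inverseʳ (1-q^ 1) (1-q^-≡1 1 0 (s≤s z≤n))))

  ratioSum : ℕ → PS
  ratioSum n = ∑ (suc N) (λ m → weight m *ₚ ratio∞ 2 (2 ℕ.* m) (2 ℕ.* n))

  F₁-term : ℕ → PS
  F₁-term n = poch∞ (2 ℕ.* n ℕ.+ 2) 2 *ₚ poch∞ (2 ℕ.* n ℕ.+ 2 ℕ.* (2 ℕ.+ N)) 2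
                *ₚ inv (poch∞ (2 ℕ.* n ℕ.+ 1) 2 *ₚ poch∞ (2 ℕ.* n ℕ.+ 1) 2) *ₚ X^ (2 ℕ.* n ℕ.+ 1)

  commonFactor : ℕ → PS
  commonFactor n = prefactor *ₚ (1-q^ 1 *ₚ 1-q^ 1) *ₚ X^ (2 ℕ.* n)
                     *ₚ (poch∞ (2 ℕ.* n ℕ.+ 2) 2 *ₚ poch∞ (2 ℕ.* n ℕ.+ 2 ℕ.* (2 ℕ.+ N)) 2 *ₚ (inv C *ₚ inv C))
    where C = poch∞ (2 ℕ.* n ℕ.+ 1) 2

  weighted-ratio-difference : ∀ n m → m ≤ N →
    weight m *ₚ (ratio∞ 2 (2 ℕ.* m) (2 ℕ.* n ℕ.+ 2) -ₚ ratio∞ 2 (2 ℕ.* m) (2 ℕ.* n))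
      ≐ commonFactor n *ₚ vandermondeTerm 3 2 N (2 ℕ.* n ℕ.+ 1) m
  weighted-ratio-difference n m m≤N = begin
    weight m *ₚ (ratio∞ 2 (2 ℕ.* m) (2 ℕ.* n ℕ.+ 2) -ₚ ratio∞ 2 (2 ℕ.* m) (2 ℕ.* n))
      ≈⟨ *-congˡ {weight m} (ratio∞-difference 2 (2 ℕ.* m) (2 ℕ.* n)) ⟩
    weight m *ₚ (X^ (2 ℕ.* n) *ₚ (1-q^ 1 *ₚ (w *ₚ (A *ₚ B *ₚ I))))
      ≈⟨ *-congˡ {weight m} (*-congˡ {X^ (2 ℕ.* n)} (*-congˡ {1-q^ 1} (*-congˡ {w} tail-split))) ⟩
    weight m *ₚ (X^ (2 ℕ.* n) *ₚ (1-q^ 1 *ₚ (w *ₚ (T *ₚ Q))))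
      ≈⟨ regroup prefactor (1-q^ 1) e (inv w) (X^ (2 ℕ.* n)) w (T *ₚ Q) ⟩
    G *ₚ (e *ₚ (T *ₚ Q)) *ₚ (w *ₚ inv w)
      ≈⟨ *-cong (*-congˡ {G} (*-CS.x∙yz≈y∙xz e T Q)) (*-inverseʳ w (1-q^-≡1 (2 ℕ.* m ℕ.+ 1) 0 (ℕP.m≤n+m 1 (2 ℕ.* m)))) ⟩
    G *ₚ (T *ₚ (e *ₚ Q)) *ₚ 1ₚ
      ≈⟨ ≈-trans (*-identityʳ (G *ₚ (T *ₚ (e *ₚ Q)))) (≈-sym (*-assoc G T (e *ₚ Q))) ⟩
    commonFactor n *ₚ vandermondeTerm 3 2 N (2 ℕ.* n ℕ.+ 1) m
      ∎
    where
    open ≈-Reasoning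
    open Solver
    w  = 1-q^ (2 ℕ.* m ℕ.+ 1)
    A  = poch∞ (2 ℕ.* n ℕ.+ 2) 2
    B  = poch∞ (2 ℕ.* n ℕ.+ 2 ℕ.* m ℕ.+ 2 ℕ.+ 2) 2
    B∞ = poch∞ (2 ℕ.* n ℕ.+ 2 ℕ.* (2 ℕ.+ N)) 2
    C  = poch∞ (2 ℕ.* n ℕ.+ 1) 2
    I  = inv (poch∞ (2 ℕ.* n ℕ.+ 1) 2 *ₚ poch∞ (2 ℕ.* n ℕ.+ 2 ℕ.* m ℕ.+ 1) 2)
    P₁ = poch (2 ℕ.* n ℕ.+ 1) 2 m
    P₂ = poch (2 ℕ.* n ℕ.+ 1 ℕ.+ 3 ℕ.+ 2 ℕ.* m) 2 (N ∸ m)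
    D  = poch∞ (2 ℕ.* n ℕ.+ 2 ℕ.* m ℕ.+ 1) 2
    C₀≡1 : C 0 ≡ + 1
    C₀≡1 = poch∞-≡1 (2 ℕ.* n ℕ.+ 1) 2 0 (ℕP.m≤n+m 1 (2 ℕ.* n))
    D₀≡1 : D 0 ≡ + 1
    D₀≡1 = poch∞-≡1 (2 ℕ.* n ℕ.+ 2 ℕ.* m ℕ.+ 1) 2 0 (ℕP.m≤n+m 1 (2 ℕ.* n ℕ.+ 2 ℕ.* m))
    arith₁ : ∀ n m → 2 ℕ.* n ℕ.+ 2 ℕ.* m ℕ.+ 2 ℕ.+ 2 ≡ 2 ℕ.* n ℕ.+ 1 ℕ.+ 3 ℕ.+ 2 ℕ.* m
    arith₁ = ℕ-Solver.solve-∀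
    arith₂ : ∀ n m r → 2 ℕ.* n ℕ.+ 1 ℕ.+ 3 ℕ.+ 2 ℕ.* m ℕ.+ 2 ℕ.* r ≡ 2 ℕ.* n ℕ.+ 2 ℕ.* (2 ℕ.+ (m ℕ.+ r))
    arith₂ = ℕ-Solver.solve-∀
    arith₃ : ∀ n m → 2 ℕ.* n ℕ.+ 1 ℕ.+ 2 ℕ.* m ≡ 2 ℕ.* n ℕ.+ 2 ℕ.* m ℕ.+ 1
    arith₃ = ℕ-Solver.solve-∀
    split-B : B ≐ P₂ *ₚ B∞
    split-B = ≈-trans (poch∞-cong 2 (arith₁ n m))
              (≈-trans (poch∞-split (2 ℕ.* n ℕ.+ 1 ℕ.+ 3 ℕ.+ 2 ℕ.* m) 2 (N ∸ m))
                       (*-congˡ {P₂} (poch∞-cong 2 (trans (arith₂ n m (N ∸ m))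
                                                          (cong (λ k → 2 ℕ.* n ℕ.+ 2 ℕ.* (2 ℕ.+ k)) (ℕP.m+[n∸m]≡n m≤N))))))
    peel-I : I ≐ inv C *ₚ (P₁ *ₚ inv C)
    peel-I = ≈-trans (inv-* C₀≡1 D₀≡1)
                     (*-congˡ {inv C} (inv-factor P₁ D₀≡1 C₀≡1
                        (≈-trans (poch∞-split (2 ℕ.* n ℕ.+ 1) 2 m) (*-congˡ {P₁} (poch∞-cong 2 (arith₃ n m))))))
    e  = σ 3 2 m *ₚ qBinomial 2 N m
    G  = prefactor *ₚ (1-q^ 1 *ₚ 1-q^ 1) *ₚ X^ (2 ℕ.* n)
    T  = A *ₚ B∞ *ₚ (inv C *ₚ inv C)
    Q  = P₁ *ₚ P₂
    tail-split : A *ₚ B *ₚ I ≐ T *ₚ Q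
    tail-split = ≈-trans (*-cong (*-congˡ {A} split-B) peel-I) (shuffle A P₂ B∞ (inv C) P₁)
      where
      shuffle : ∀ A P₂ B∞ C⁻¹ P₁ → A *ₚ (P₂ *ₚ B∞) *ₚ (C⁻¹ *ₚ (P₁ *ₚ C⁻¹)) ≐ A *ₚ B∞ *ₚ (C⁻¹ *ₚ C⁻¹) *ₚ (P₁ *ₚ P₂)
      shuffle = solve 5 (λ A P₂ B∞ C⁻¹ P₁ →
        A :* (P₂ :* B∞) :* (C⁻¹ :* (P₁ :* C⁻¹)) := A :* B∞ :* (C⁻¹ :* C⁻¹) :* (P₁ :* P₂)) ≈-refl
    regroup : ∀ pre o e w⁻¹ y w X → pre *ₚ (o *ₚ (e *ₚ w⁻¹)) *ₚ (y *ₚ (o *ₚ (w *ₚ X))) ≐ pre *ₚ (o *ₚ o) *ₚ y *ₚ (e *ₚ X) *ₚ (w *ₚ w⁻¹)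
    regroup = solve 7 (λ pre o e w⁻¹ y w X →
      pre :* (o :* (e :* w⁻¹)) :* (y :* (o :* (w :* X))) := pre :* (o :* o) :* y :* (e :* X) :* (w :* w⁻¹)) ≈-refl

  commonFactor-*-poch : ∀ n → commonFactor n *ₚ poch 3 2 N ≐ F₁-term n
  commonFactor-*-poch n = begin
    prefactor *ₚ (1-q^ 1 *ₚ 1-q^ 1) *ₚ X^ (2 ℕ.* n) *ₚ T *ₚ poch 3 2 N
      ≈⟨ regroup prefactor (1-q^ 1) (X^ (2 ℕ.* n)) T (poch 3 2 N) ⟩
    X^ 1 *ₚ inv W *ₚ (1-q^ 1 *ₚ (1-q^ 1 *ₚ poch 3 2 N)) *ₚ (T *ₚ X^ (2 ℕ.* n))
      ≈⟨ *-congʳ {T *ₚ X^ (2 ℕ.* n)} (≈-trans (*-assoc (X^ 1) (inv W) (1-q^ 1 *ₚ (1-q^ 1 *ₚ poch 3 2 N))) (≈-trans (*-congˡ {X^ 1} cancel) (*-identityʳ (X^ 1)))) ⟩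
    X^ 1 *ₚ (T *ₚ X^ (2 ℕ.* n))
      ≈⟨ *-CS.x∙yz≈y∙xz (X^ 1) T (X^ (2 ℕ.* n)) ⟩
    T *ₚ (X^ 1 *ₚ X^ (2 ℕ.* n))
      ≈⟨ *-cong (*-congˡ {A *ₚ B∞} (≈-sym (inv-* C₀≡1 C₀≡1)))
                (≈-trans (X^-+ 1 (2 ℕ.* n)) (X^-cong (ℕP.+-comm 1 (2 ℕ.* n)))) ⟩
    F₁-term n
      ∎
    where
    open ≈-Reasoning
    open Solver
    W  = 1-q^ 1 *ₚ poch 1 2 (suc N)
    A  = poch∞ (2 ℕ.* n ℕ.+ 2) 2
    B∞ = poch∞ (2 ℕ.* n ℕ.+ 2 ℕ.* (2 ℕ.+ N)) 2
    C  = poch∞ (2 ℕ.* n ℕ.+ 1) 2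
    T  = A *ₚ B∞ *ₚ (inv C *ₚ inv C)
    C₀≡1 : C 0 ≡ + 1
    C₀≡1 = poch∞-≡1 (2 ℕ.* n ℕ.+ 1) 2 0 (ℕP.m≤n+m 1 (2 ℕ.* n))
    W₀≡1 : W 0 ≡ + 1
    W₀≡1 = *-const≡1 (1-q^ 1) (poch 1 2 (suc N)) (1-q^-≡1 1 0 (s≤s z≤n)) (poch-≡1 1 2 (suc N) 0 (s≤s z≤n))
    cancel : inv W *ₚ (1-q^ 1 *ₚ (1-q^ 1 *ₚ poch 3 2 N)) ≐ 1ₚ
    cancel = ≈-trans (*-congˡ {inv W} (*-congˡ {1-q^ 1} (≈-sym (poch-suc 1 2 N))))
                     (≈-trans (*-comm (inv W) W) (*-inverseʳ W W₀≡1))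
    regroup : ∀ pre o y T P → pre *ₚ (o *ₚ o) *ₚ y *ₚ T *ₚ P ≐ pre *ₚ (o *ₚ (o *ₚ P)) *ₚ (T *ₚ y)
    regroup = solve 5 (λ pre o y T P → pre :* (o :* o) :* y :* T :* P := pre :* (o :* (o :* P)) :* (T :* y)) ≈-refl

  F₁-term-telescopes : ∀ n → F₁-term n ≐ ratioSum (suc n) -ₚ ratioSum n
  F₁-term-telescopes n = ≈-sym (begin
    ratioSum (suc n) -ₚ ratioSum n
      ≈⟨ ∑-difference (suc N) (λ m → weight m *ₚ ratio∞ 2 (2 ℕ.* m) (2 ℕ.* suc n)) (λ m → weight m *ₚ ratio∞ 2 (2 ℕ.* m) (2 ℕ.* n)) ⟩
    ∑ (suc N) (λ m → weight m *ₚ ratio∞ 2 (2 ℕ.* m) (2 ℕ.* suc n) -ₚ weight m *ₚ ratio∞ 2 (2 ℕ.* m) (2 ℕ.* n))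
      ≈⟨ ∑-cong (suc N) (λ m m<1+N → step m (ℕP.≤-pred m<1+N)) ⟩
    ∑ (suc N) (λ m → commonFactor n *ₚ vandermondeTerm 3 2 N (2 ℕ.* n ℕ.+ 1) m)
      ≈⟨ *-distribˡ-∑ (commonFactor n) (suc N) (vandermondeTerm 3 2 N (2 ℕ.* n ℕ.+ 1)) ⟨
    commonFactor n *ₚ ∑ (suc N) (vandermondeTerm 3 2 N (2 ℕ.* n ℕ.+ 1))
      ≈⟨ *-congˡ {commonFactor n} (qChuVandermonde 3 2 N (2 ℕ.* n ℕ.+ 1)) ⟩
    commonFactor n *ₚ poch 3 2 N
      ≈⟨ commonFactor-*-poch n ⟩
    F₁-term n
      ∎)
    where
    open ≈-Reasoning
    open Solver
    factor : ∀ x a b → x *ₚ a -ₚ x *ₚ b ≐ x *ₚ (a -ₚ b)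
    factor = solve 3 (λ x a b → x :* a :- x :* b := x :* (a :- b)) ≈-refl
    2[1+n] : 2 ℕ.* suc n ≡ 2 ℕ.* n ℕ.+ 2
    2[1+n] = trans (ℕP.*-suc 2 n) (ℕP.+-comm 2 (2 ℕ.* n))
    step : ∀ m → m ≤ N →
      weight m *ₚ ratio∞ 2 (2 ℕ.* m) (2 ℕ.* suc n) -ₚ weight m *ₚ ratio∞ 2 (2 ℕ.* m) (2 ℕ.* n)
        ≐ commonFactor n *ₚ vandermondeTerm 3 2 N (2 ℕ.* n ℕ.+ 1) m
    step m m≤N = ≈-trans (factor (weight m) (ratio∞ 2 (2 ℕ.* m) (2 ℕ.* suc n)) (ratio∞ 2 (2 ℕ.* m) (2 ℕ.* n)))
                         (≈-trans (*-congˡ {weight m} (+-congʳ {negₚ (ratio∞ 2 (2 ℕ.* m) (2 ℕ.* n))}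
                                                         (≈-reflexive (cong (ratio∞ 2 (2 ℕ.* m)) 2[1+n]))))
                                  (weighted-ratio-difference n m m≤N))

  ratioSum-zero : ratioSum 0 ≐ 0ₚ
  ratioSum-zero = ∑-zero (suc N) (λ m _ → ≈-trans (*-congˡ {weight m} (ratio∞-zero 2 (2 ℕ.* m))) (zeroʳ (weight m)))

  ratioSum-≡-∑weight : ∀ M → ratioSum (suc M) ≡ ∑ (suc N) weight mod-q^ suc M
  ratioSum-≡-∑weight M = ∑-mod (suc N) (λ m _ i i≤M →
    trans (*ₚ-mod {weight m} (λ _ _ → refl) (ratio≡1 m) i i≤M) (*-identityʳ (weight m) i))
    where
    ratio≡1 : ∀ m → ratio∞ 2 (2 ℕ.* m) (2 ℕ.* suc M) ≡ 1ₚ mod-q^ suc M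
    ratio≡1 m = mod-q^-weaken (ℕP.m≤n*m (suc M) 2) (ratio∞-≡1 2 (2 ℕ.* m) (2 ℕ.* suc M))

  F₁≐RHS : F₁ (2 ℕ.+ N) ≐ RHS (2 ℕ.+ N)
  F₁≐RHS M = begin
    F₁ (2 ℕ.+ N) M                                    ≡⟨ sum∞-∑ F₁-term M ⟩
    ∑ (suc M) F₁-term M                               ≡⟨ ∑-cong (suc M) (λ n _ → F₁-term-telescopes n) M ⟩
    ∑ (suc M) (λ n → ratioSum (suc n) -ₚ ratioSum n) M ≡⟨ ∑-telescope (suc M) ratioSum M ⟩
    ratioSum (suc M) M ℤ.- ratioSum 0 M               ≡⟨ cong₂ ℤ._-_ (ratioSum-≡-∑weight M M ℕP.≤-refl) (ratioSum-zero M) ⟩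
    ∑ (suc N) weight M ℤ.- + 0                        ≡⟨ ℤP.+-identityʳ _ ⟩
    ∑ (suc N) weight M                                ≡⟨ RHS≐∑weight M ⟨
    RHS (2 ℕ.+ N) M                                   ∎
    where open ≡-Reasoning

-- The identity holds from k = 2 on (with an empty sum); the hypothesis only rules out
-- k ≤ 1, where the truncated k ∸ 1 and k ∸ 2 make the right-hand side meaningless.
lemma3p1 : (k : ℕ) → 3 ≤ k → F₁ k ≐ RHS k
lemma3p1 1             (s≤s ())
lemma3p1 (suc (suc N)) _       = F₁≐RHS N
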